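{- Let $n\neq 1$ be a positive integer. If $\varphi(2^n-1)\geq 2^{n-1}$, where $\varphi$ is Euler's totient function, then $\ell_{\mathbb{F}_{2^n}}\geq 3(2^n-1)$.
   Context: Let $A$ be a commutative unital ring ($0_A\neq 1_A$). For $a_1,\ldots,a_n\in A$ set $M_n(a_1,\ldots,a_n)=\begin{pmatrix} a_n & -1_A\\ 1_A & 0_A\end{pmatrix}\cdots\begin{pmatrix} a_1 & -1_A\\ 1_A & 0_A\end{pmatrix}$. An $n$-tuple is a $\lambda$-quiddity (solution of $(E_A)$) if $M_n(a_1,\ldots,a_n)=\pm \mathrm{Id}$. For tuples, $(a_1,\ldots,a_n)\oplus(b_1,\ldots,b_m)=(a_1+b_m,a_2,\ldots,a_{n-1},a_n+b_1,b_2,\ldots,b_{m-1})$. Write $(a_1,\ldots,a_n)\sim(b_1,\ldots,b_n)$ if $(b_1,\ldots,b_n)$ is obtained from $(a_1,\ldots,a_n)$ or from $(a_n,\ldots,a_1)$ by a cyclic permutation. A $\lambda$-quiddity $(c_1,\ldots,c_n)$ with $n\geq 3$ is reducible if there exist a $\lambda$-quiddity $(b_1,\ldots,b_l)$ and a tuple $(a_1,\ldots,a_m)$ with $l,m\geq 3$ and $(c_1,\ldots,c_n)\sim(a_1,\ldots,a_m)\oplus(b_1,\ldots,b_l)$; otherwise it is irreducible. When $A$ is finite, there are only finitely many irreducible $\lambda$-quiddities over $A$, and $\ell_A$ denotes their maximal size. $\mathbb{F}_q$ is the field with $q$ elements. -}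

module Defs where

open import Level using (Level; _⊔_)
open import Data.Nat as ℕ using (ℕ; zero; suc)
open import Data.Nat.Coprimality using (coprime?)
open import Data.List using (List; []; _∷_; _++_; length; drop; take; reverse; filter; map; upTo; foldl)
open import Data.List.Relation.Binary.Pointwise using (Pointwise)
open import Data.Product using (Σ; ∃; _×_; _,_)
open import Data.Sum using (_⊎_)
open import Data.Fin using (Fin)
open import Relation.Nullary using (¬_)
open import Relation.Binary.PropositionalEquality using (_≡_)
import Relation.Binary.PropositionalEquality as ≡
open import Function.Bundles using (Inverse)
open import Algebra.Bundles using (CommutativeRing)

totient : ℕ → ℕ
totient m = length (filter (λ k → coprime? k m) (map suc (upTo m)))

module _ {c ℓ : Level} (R : CommutativeRing c ℓ) where
  open CommutativeRing R

  IsField : Set (c ⊔ ℓ)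
  IsField = (¬ (0# ≈ 1#)) × (∀ x → ¬ (x ≈ 0#) → ∃ λ y → (x * y) ≈ 1#)

  HasCard : ℕ → Set (c ⊔ ℓ)
  HasCard q = Inverse setoid (≡.setoid (Fin q))

  record Mat : Set c where
    constructor mat
    field
      m11 m12 m21 m22 : Carrier

  _⊗_ : Mat → Mat → Mat
  mat a b c' d ⊗ mat e f g h =
    mat (a * e + b * g) (a * f + b * h) (c' * e + d * g) (c' * f + d * h)

  _≈M_ : Mat → Mat → Set ℓ
  mat a b c' d ≈M mat e f g h = (a ≈ e) × (b ≈ f) × (c' ≈ g) × (d ≈ h)

  IdM : Mat
  IdM = mat 1# 0# 0# 1#

  negIdM : Mat
  negIdM = mat (- 1#) 0# 0# (- 1#)

  elemM : Carrier → Mat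
  elemM a = mat a (- 1#) 1# 0#

  Mn : List Carrier → Mat
  Mn = foldl (λ acc a → elemM a ⊗ acc) IdM

  IsQuiddity : List Carrier → Set ℓ
  IsQuiddity as = (Mn as ≈M IdM) ⊎ (Mn as ≈M negIdM)

  -- helpers for ⊕ (only used on lists of length ≥ 3)
  lastOr : Carrier → List Carrier → Carrier
  lastOr d []       = d
  lastOr d (x ∷ xs) = lastOr x xs

  dropLast : List Carrier → List Carrier
  dropLast []           = []
  dropLast (x ∷ [])     = []
  dropLast (x ∷ y ∷ ys) = x ∷ dropLast (y ∷ ys)

  addLast : Carrier → List Carrier → List Carrier
  addLast b []           = []
  addLast b (x ∷ [])     = (x + b) ∷ []
  addLast b (x ∷ y ∷ ys) = x ∷ addLast b (y ∷ ys)

  -- (a_1,…,a_m) ⊕ (b_1,…,b_l) = (a_1+b_l, a_2,…,a_{m-1}, a_m+b_1, b_2,…,b_{l-1})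
  _⊕_ : List Carrier → List Carrier → List Carrier
  []       ⊕ bs       = bs
  (a ∷ as) ⊕ []       = a ∷ as
  (a ∷ as) ⊕ (b ∷ bs) = (a + lastOr b bs) ∷ (addLast b as ++ dropLast bs)

  _≈L_ : List Carrier → List Carrier → Set (c ⊔ ℓ)
  _≈L_ = Pointwise _≈_

  rotate : ℕ → List Carrier → List Carrier
  rotate k xs = drop k xs ++ take k xs

  _∼_ : List Carrier → List Carrier → Set (c ⊔ ℓ)
  xs ∼ ys = ∃ λ k → (k ℕ.< length xs) ×
              ((rotate k xs ≈L ys) ⊎ (rotate k (reverse xs) ≈L ys))

  Reducible : List Carrier → Set (c ⊔ ℓ)
  Reducible cs = ∃ λ as → ∃ λ bs →
    IsQuiddity bs × (3 ℕ.≤ length bs) × (3 ℕ.≤ length as) × (cs ∼ (as ⊕ bs))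

  Irreducible : List Carrier → Set (c ⊔ ℓ)
  Irreducible cs = IsQuiddity cs × (3 ℕ.≤ length cs) × ¬ Reducible cs

module Submission where

-- Let F have q = 2ⁿ elements. F^× is cyclic: an element of maximal order e satisfies
-- yᵉ = 1 for all y ≠ 0, and X^(e+1) - X has at most e + 1 roots, so e = q - 1. Then
-- (-1)^(q-1) = 1 with q - 1 odd gives characteristic 2. There are φ(q - 1) ≥ q/2 generators
-- of F^×, while the q - 2 elements s ∉ {0, 1} fall into pairs {s, s⁻¹} and give fewer than
-- q/2 sums s + s⁻¹; so some generator t is not of the form s + s⁻¹.
-- With u = t⁻¹, the tuple (u, u, t)^(q-1) is a λ-quiddity: in characteristic 2 the matrix
-- of (u, u, t) is triangular with diagonal (t, u). If it were reducible, a rotation or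
-- reflection of it would be (a ⊕ b) for a λ-quiddity b = (b₁, …, b_l), making the matrix of
-- the proper nonempty block (b₂, …, b_{l-1}) have top-left entry ±1 = 1. For the blocks of
-- (u, u, t)^(q-1) that entry is tʲ or uʲ with 0 < j < q - 1, or 0, or a v with
-- t v = tʲ + uʲ = tʲ + (tʲ)⁻¹, and none of these is 1.

open import Level using (Level; _⊔_)
open import Algebra.Bundles using (CommutativeRing; RawRing)
open import Data.Nat as ℕ using (ℕ; zero; suc; _≤_; _<_; z≤n; s≤s; NonZero)
import Data.Nat.Properties as ℕ
open import Data.Nat.Divisibility
  using ( _∣_; _∤_; _∣?_; divides; 1∣_; ∣⇒≤; ∣-trans; ∣1⇒≡1; n∣m*n; m∣m*n; ∣m⇒∣m*n; *-cancelˡ-∣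
        ; m%n≡0⇒n∣m; quotient; m∣n⇒n≡quotient*m)
open import Data.Nat.DivMod using (_%_; _/_; m%n<n; m≡m%n+[m/n]*n)
open import Data.Nat.GCD using (gcd; gcd[m,n]∣m; gcd[m,n]∣n; gcd-greatest)
open import Data.Nat.LCM using (lcm; lcm-least; gcd*lcm)
open import Data.Nat.Induction using (<-rec)
open import Data.Nat.ListAction using (product)
open import Data.Nat.Primality using (Prime; prime⇒irreducible; prime⇒nonTrivial)
open import Data.Nat.Primality.Factorisation using (factorise)
open import Data.Nat.Coprimality as Coprime using (Coprime; coprime?; coprime-divisor; coprime⇒gcd≡1)
open import Data.Product using (∃; ∃₂; _×_; _,_; proj₁; proj₂)
open import Data.Sum using (_⊎_; inj₁; inj₂; [_,_])
open import Data.Bool using (Bool; true; false; _xor_; _∧_)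
open import Data.Bool.Properties using (xor-∧-commutativeRing)
open import Data.Maybe using (Maybe; just; nothing)
open import Data.Empty using (⊥-elim)
open import Data.Fin as Fin using (Fin)
import Data.Fin.Properties as FinP
open import Data.List
  using ( List; []; _∷_; _++_; foldl; length; drop; take; reverse; lookup; replicate; applyUpTo
        ; tabulate; filter; map; upTo)
import Data.List.Properties as List
import Data.List.Relation.Unary.All.Properties as All
import Data.List.Relation.Unary.AllPairs.Properties as AllPairs
open import Data.List.Membership.Propositional.Properties using (∈-lookup)
open import Data.List.Relation.Binary.Pointwise using (Pointwise; []; _∷_; Pointwise-length)
open import Data.List.Relation.Unary.All as All using (All; []; _∷_)
open import Function using (_∘_)
open import Function.Bundles using (Inverse)
open import Relation.Nullary using (¬_; Dec; yes; no)
open import Relation.Nullary.Decidable using (map′; _×-dec_; _⊎-dec_)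
open import Relation.Binary.Bundles using (Setoid)
open import Relation.Binary.Structures using (IsEquivalence)
open import Relation.Binary.PropositionalEquality as ≡ using (_≡_; _≢_)
open import Defs

module Arithmetic where
  open import Data.Nat using (_+_; _*_; _^_; _∸_)

  ∣∧<⇒≡0 : ∀ {a d} → a ∣ d → d < a → d ≡ 0
  ∣∧<⇒≡0 {d = zero}  a∣d d<a = ≡.refl
  ∣∧<⇒≡0 {d = suc d} a∣d d<a = ⊥-elim (ℕ.<⇒≱ d<a (∣⇒≤ a∣d))

  p-adic-decomposition : ∀ {p} → 1 < p → ∀ a → a ≢ 0 → ∃₂ λ i a₀ → a ≡ p ^ i * a₀ × p ∤ a₀
  p-adic-decomposition {p} 1<p = <-rec _ decompose
    where
    decompose : ∀ a → (∀ {a′} → a′ < a → a′ ≢ 0 → ∃₂ λ i a₀ → a′ ≡ p ^ i * a₀ × p ∤ a₀) →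
                a ≢ 0 → ∃₂ λ i a₀ → a ≡ p ^ i * a₀ × p ∤ a₀
    decompose a rec a≢0 with p ∣? a
    ... | no p∤a = 0 , a , ≡.sym (ℕ.+-identityʳ a) , p∤a
    ... | yes (divides a′ a≡a′p) with rec a′<a a′≢0
      where
      a′≢0 : a′ ≢ 0
      a′≢0 ≡.refl = a≢0 a≡a′p
      a′<a : a′ < a
      a′<a = ≡.subst (a′ <_) (≡.sym a≡a′p) (ℕ.m<m*n a′ p {{ℕ.≢-nonZero a′≢0}} 1<p)
    ... | i , a₀ , a′≡pⁱa₀ , p∤a₀ = suc i , a₀ , a≡pⁱ⁺¹a₀ , p∤a₀
      where
      a≡pⁱ⁺¹a₀ : a ≡ p * p ^ i * a₀
      a≡pⁱ⁺¹a₀ = ≡.trans a≡a′p (≡.trans (ℕ.*-comm a′ p)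
                   (≡.trans (≡.cong (p *_) a′≡pⁱa₀) (≡.sym (ℕ.*-assoc p (p ^ i) a₀))))

  prime-divisor : ∀ {n} → n ≢ 0 → n ≢ 1 → ∃ λ p → Prime p × p ∣ n
  prime-divisor {n} n≢0 n≢1 with factorise n {{ℕ.≢-nonZero n≢0}}
  ... | record { factors = [] ; isFactorisation = n≡1 } = ⊥-elim (n≢1 n≡1)
  ... | record { factors = p ∷ ps ; isFactorisation = n≡p*ps ; factorsPrime = p-prime ∷ _ } =
    p , p-prime , divides (product ps) (≡.trans n≡p*ps (ℕ.*-comm p (product ps)))

  prime∤⇒coprime-^ : ∀ {p a} → Prime p → p ∤ a → ∀ k → Coprime a (p ^ k)
  prime∤⇒coprime-^ p-prime p∤a zero    (_ , d∣1) = ∣1⇒≡1 d∣1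
  prime∤⇒coprime-^ {p} {a} p-prime p∤a (suc k) {d} (d∣a , d∣pᵏ⁺¹) =
    prime∤⇒coprime-^ p-prime p∤a k (d∣a , coprime-divisor d⊥p d∣pᵏ⁺¹)
    where
    d⊥p : Coprime d p
    d⊥p {e} (e∣d , e∣p) with prime⇒irreducible p-prime e∣p
    ... | inj₁ e≡1 = e≡1
    ... | inj₂ ≡.refl = ⊥-elim (p∤a (∣-trans e∣d d∣a))

  coprime⇒*∣ : ∀ {m n k} → Coprime m n → m ∣ k → n ∣ k → m * n ∣ k
  coprime⇒*∣ {m} {n} m⊥n m∣k n∣k = ≡.subst (_∣ _) lcm≡mn (lcm-least m∣k n∣k)
    where
    open ≡.≡-Reasoning
    lcm≡mn : lcm m n ≡ m * n
    lcm≡mn = begin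
      lcm m n            ≡⟨ ℕ.*-identityˡ (lcm m n) ⟨
      1 * lcm m n        ≡⟨ ≡.cong (_* lcm m n) (coprime⇒gcd≡1 m⊥n) ⟨
      gcd m n * lcm m n  ≡⟨ gcd*lcm m n ⟩
      m * n              ∎

  prime>1 : ∀ {p} → Prime p → 1 < p
  prime>1 {p} p-prime = ℕ.nonTrivial⇒n>1 p {{prime⇒nonTrivial p-prime}}

  ^-monoʳ-∣ : ∀ p {k i} → k ≤ i → p ^ k ∣ p ^ i
  ^-monoʳ-∣ p {k} {i} k≤i = divides (p ^ (i ∸ k)) (begin
    p ^ i                ≡⟨ ≡.cong (p ^_) (ℕ.m+[n∸m]≡n k≤i) ⟨
    p ^ (k + (i ∸ k))    ≡⟨ ℕ.^-distribˡ-+-* p k (i ∸ k) ⟩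
    p ^ k * p ^ (i ∸ k)  ≡⟨ ℕ.*-comm (p ^ k) _ ⟩
    p ^ (i ∸ k) * p ^ k  ∎)
    where open ≡.≡-Reasoning

  ∤⇒prime∣gcd-cofactor : ∀ {a b} → b ≢ 0 → b ∤ a → ∃₂ λ p b′ → Prime p × p ∣ b′ × b ≡ b′ * gcd a b
  ∤⇒prime∣gcd-cofactor {a} {b} b≢0 b∤a with divides b′ b≡b′g ← gcd[m,n]∣n a b =
    let p , p-prime , p∣b′ = prime-divisor b′≢0 b′≢1 in p , b′ , p-prime , p∣b′ , b≡b′g
    where
    b′≢0 : b′ ≢ 0
    b′≢0 ≡.refl = b≢0 b≡b′g
    b′≢1 : b′ ≢ 1
    b′≢1 ≡.refl = b∤a (≡.subst (_∣ a) (≡.trans (≡.sym (ℕ.*-identityˡ _)) (≡.sym b≡b′g)) (gcd[m,n]∣m a b))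

  -- If k ≤ i then pᵏ divides gcd a b, so p, which divides b / gcd a b, also divides b₀.
  gcd-cofactor⇒valuation< : ∀ {p a b b′ i k a₀ b₀} → 1 < p → p ∣ b′ → b ≡ b′ * gcd a b →
    a ≡ p ^ i * a₀ → b ≡ p ^ k * b₀ → p ∤ b₀ → i < k
  gcd-cofactor⇒valuation< {p} {a} {b} {b′} {i} {k} {a₀} {b₀} 1<p p∣b′ b≡b′g a≡pⁱa₀ b≡pᵏb₀ p∤b₀ =
    ℕ.≰⇒> (λ k≤i → p∤b₀ (≡.subst (p ∣_) (≡.sym (b₀≡b′g′ k≤i)) (∣m⇒∣m*n _ p∣b′)))
    where
    open ≡.≡-Reasoning
    pᵏ∣b : p ^ k ∣ b
    pᵏ∣b = divides b₀ (≡.trans b≡pᵏb₀ (ℕ.*-comm (p ^ k) b₀))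
    pᵏ∣g : k ≤ i → p ^ k ∣ gcd a b
    pᵏ∣g k≤i = gcd-greatest (≡.subst (p ^ k ∣_) (≡.sym a≡pⁱa₀) (∣m⇒∣m*n a₀ (^-monoʳ-∣ p k≤i))) pᵏ∣b
    b₀≡b′g′ : (k≤i : k ≤ i) → b₀ ≡ b′ * quotient (pᵏ∣g k≤i)
    b₀≡b′g′ k≤i = ℕ.*-cancelʳ-≡ b₀ (b′ * g′) (p ^ k)
                    {{ℕ.m^n≢0 p k {{ℕ.>-nonZero (ℕ.<-trans ℕ.0<1+n 1<p)}}}} (begin
      b₀ * p ^ k           ≡⟨ ℕ.*-comm b₀ (p ^ k) ⟩
      p ^ k * b₀           ≡⟨ b≡pᵏb₀ ⟨
      b                    ≡⟨ b≡b′g ⟩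
      b′ * gcd a b         ≡⟨ ≡.cong (b′ *_) (m∣n⇒n≡quotient*m (pᵏ∣g k≤i)) ⟩
      b′ * (g′ * p ^ k)    ≡⟨ ℕ.*-assoc b′ g′ (p ^ k) ⟨
      b′ * g′ * p ^ k      ∎)
      where
      g′ : ℕ
      g′ = quotient (pᵏ∣g k≤i)

  -- If b ∤ a then some prime p occurs to a higher power pᵏ in b than in a = pⁱ a₀;
  -- the factors a₀ and pᵏ are the ones returned.
  larger-coprime-product : ∀ {a b} → a ≢ 0 → b ≢ 0 → b ∤ a →
    ∃₂ λ a₀ b₀ → a₀ ∣ a × b₀ ∣ b × Coprime a₀ b₀ × a < a₀ * b₀
  larger-coprime-product {a} {b} a≢0 b≢0 b∤a
    with p , b′ , p-prime , p∣b′ , b≡b′g ← ∤⇒prime∣gcd-cofactor b≢0 b∤a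
    with i , a₀ , a≡pⁱa₀ , p∤a₀ ← p-adic-decomposition (prime>1 p-prime) a a≢0
    with k , b₀ , b≡pᵏb₀ , p∤b₀ ← p-adic-decomposition (prime>1 p-prime) b b≢0 =
    a₀ , p ^ k , divides (p ^ i) a≡pⁱa₀ , divides b₀ (≡.trans b≡pᵏb₀ (ℕ.*-comm (p ^ k) b₀)) ,
    prime∤⇒coprime-^ p-prime p∤a₀ k , ≡.subst (_< a₀ * p ^ k) (≡.sym a≡pⁱa₀) pⁱa₀<a₀pᵏ
    where
    i<k : i < k
    i<k = gcd-cofactor⇒valuation< (prime>1 p-prime) p∣b′ b≡b′g a≡pⁱa₀ b≡pᵏb₀ p∤b₀
    a₀≢0 : a₀ ≢ 0
    a₀≢0 ≡.refl = a≢0 (≡.trans a≡pⁱa₀ (ℕ.*-zeroʳ (p ^ i)))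
    pⁱa₀<a₀pᵏ : p ^ i * a₀ < a₀ * p ^ k
    pⁱa₀<a₀pᵏ = ≡.subst (p ^ i * a₀ <_) (ℕ.*-comm (p ^ k) a₀)
                  (ℕ.*-monoˡ-< a₀ {{ℕ.≢-nonZero a₀≢0}} (ℕ.^-monoʳ-< p (prime>1 p-prime) i<k))

open Arithmetic

module Powers {c ℓ} (R : CommutativeRing c ℓ) where
  open CommutativeRing R
  open import Algebra.Properties.CommutativeSemiring.Exp commutativeSemiring public
  open import Algebra.Properties.Ring ring using (-1*x≈-x; -‿involutive)
  open import Relation.Binary.Reasoning.Setoid setoid

  1^n≈1 : ∀ n → 1# ^ n ≈ 1#
  1^n≈1 zero    = refl
  1^n≈1 (suc n) = trans (*-identityˡ _) (1^n≈1 n)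

  ^≈1-∣ : ∀ {x a k} → x ^ a ≈ 1# → a ∣ k → x ^ k ≈ 1#
  ^≈1-∣ {x} {a} x^a≈1 (divides j ≡.refl) = begin
    x ^ (j ℕ.* a)  ≡⟨ ≡.cong (x ^_) (ℕ.*-comm j a) ⟩
    x ^ (a ℕ.* j)  ≈⟨ ^-assocʳ x a j ⟨
    (x ^ a) ^ j    ≈⟨ ^-congˡ j x^a≈1 ⟩
    1# ^ j         ≈⟨ 1^n≈1 j ⟩
    1#             ∎

  record _HasOrder_ (x : Carrier) (a : ℕ) : Set ℓ where
    field
      order≢0 : a ≢ 0
      ^order≈1 : x ^ a ≈ 1#
      order∣ : ∀ {k} → x ^ k ≈ 1# → a ∣ k

    ^≈1 : ∀ {k} → a ∣ k → x ^ k ≈ 1#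
    ^≈1 = ^≈1-∣ ^order≈1

  open _HasOrder_ public

  ^-hasOrder : ∀ {y} d e → y HasOrder (d ℕ.* e) → (y ^ d) HasOrder e
  ^-hasOrder {y} d e ord = record
    { order≢0 = λ { ≡.refl → order≢0 ord (ℕ.*-zeroʳ d) }
    ; ^order≈1 = trans (^-assocʳ y d e) (^order≈1 ord)
    ; order∣  = λ {k} y^dk≈1 → *-cancelˡ-∣ d {{d≢0}}
                  (order∣ ord (trans (sym (^-assocʳ y d k)) y^dk≈1))
    }
    where
    d≢0 : NonZero d
    d≢0 = ℕ.≢-nonZero λ { ≡.refl → order≢0 ord ≡.refl }

  ^-coprime-hasOrder : ∀ {g m k} → g HasOrder m → Coprime k m → (g ^ k) HasOrder m
  ^-coprime-hasOrder {g} {m} {k} ord k⊥m = record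
    { order≢0 = order≢0 ord
    ; ^order≈1 = trans (^-assocʳ g k m) (^≈1 ord (n∣m*n k))
    ; order∣  = λ {j} g^kj≈1 → coprime-divisor (Coprime.sym k⊥m)
                  (order∣ ord (trans (sym (^-assocʳ g k j)) g^kj≈1))
    }

  private
    order∣-of-product : ∀ {x y α β k} → x HasOrder α → y HasOrder β → Coprime α β →
                        (x * y) ^ k ≈ 1# → α ∣ k
    order∣-of-product {x} {y} {α} {β} {k} ox oy α⊥β xy^k≈1 =
      coprime-divisor α⊥β (≡.subst (α ∣_) (ℕ.*-comm k β) (order∣ ox x^kβ≈1))
      where
      x^kβ≈1 : x ^ (k ℕ.* β) ≈ 1#
      x^kβ≈1 = begin
        x ^ (k ℕ.* β)                  ≈⟨ *-identityʳ _ ⟨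
        x ^ (k ℕ.* β) * 1#             ≈⟨ *-congˡ (^≈1 oy (n∣m*n k)) ⟨
        x ^ (k ℕ.* β) * y ^ (k ℕ.* β)  ≈⟨ ^-distrib-* x y (k ℕ.* β) ⟨
        (x * y) ^ (k ℕ.* β)            ≈⟨ ^-assocʳ (x * y) k β ⟨
        ((x * y) ^ k) ^ β              ≈⟨ ^-congˡ β xy^k≈1 ⟩
        1# ^ β                         ≈⟨ 1^n≈1 β ⟩
        1#                             ∎

  *-hasOrder : ∀ {x y α β} → x HasOrder α → y HasOrder β → Coprime α β →
               (x * y) HasOrder (α ℕ.* β)
  *-hasOrder {x} {y} {α} {β} ox oy α⊥β = record
    { order≢0 = λ αβ≡0 → [ order≢0 ox , order≢0 oy ] (ℕ.m*n≡0⇒m≡0∨n≡0 α αβ≡0)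
    ; ^order≈1 = begin
        (x * y) ^ (α ℕ.* β)              ≈⟨ ^-distrib-* x y (α ℕ.* β) ⟩
        x ^ (α ℕ.* β) * y ^ (α ℕ.* β)    ≈⟨ *-cong (^≈1 ox (m∣m*n β)) (^≈1 oy (n∣m*n α)) ⟩
        1# * 1#                          ≈⟨ *-identityˡ 1# ⟩
        1#                               ∎
    ; order∣ = αβ∣
    }
    where
    αβ∣ : ∀ {k} → (x * y) ^ k ≈ 1# → α ℕ.* β ∣ k
    αβ∣ {k} xy^k≈1 = coprime⇒*∣ α⊥β (order∣-of-product ox oy α⊥β xy^k≈1)
      (order∣-of-product oy ox (Coprime.sym α⊥β) (trans (^-congˡ k (*-comm y x)) xy^k≈1))

  larger-order : ∀ {x y a b} → x HasOrder a → y HasOrder b → b ∤ a →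
                 ∃₂ λ z a′ → a < a′ × z HasOrder a′
  larger-order {x} {y} {a} {b} ox oy b∤a =
    combine (larger-coprime-product (order≢0 ox) (order≢0 oy) b∤a)
    where
    combine : (∃₂ λ a₀ b₀ → a₀ ∣ a × b₀ ∣ b × Coprime a₀ b₀ × a < a₀ ℕ.* b₀) →
              ∃₂ λ z a′ → a < a′ × z HasOrder a′
    combine (a₀ , b₀ , divides d a≡da₀ , divides e b≡eb₀ , a₀⊥b₀ , a<a₀b₀) =
      x ^ d * y ^ e , a₀ ℕ.* b₀ , a<a₀b₀ ,
      *-hasOrder (^-hasOrder d a₀ (≡.subst (x HasOrder_) a≡da₀ ox))
                 (^-hasOrder e b₀ (≡.subst (y HasOrder_) b≡eb₀ oy)) a₀⊥b₀

  1-hasOrder : 1# HasOrder 1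
  1-hasOrder = record
    { order≢0 = λ ()
    ; ^order≈1 = *-identityʳ 1#
    ; order∣ = λ {k} _ → 1∣ k
    }

  ^≉1-below-order : ∀ {x a k} → x HasOrder a → 0 < k → k < a → x ^ k ≉ 1#
  ^≉1-below-order {k = k} ord 0<k k<a x^k≈1 = ℕ.<⇒≱ k<a (∣⇒≤ {{ℕ.>-nonZero 0<k}} (order∣ ord x^k≈1))

  ^-*-inverse : ∀ {x y} → x * y ≈ 1# → ∀ k → x ^ k * y ^ k ≈ 1#
  ^-*-inverse {x} {y} xy≈1 k = trans (sym (^-distrib-* x y k)) (trans (^-congˡ k xy≈1) (1^n≈1 k))

  inverse-hasOrder : ∀ {x y a} → x * y ≈ 1# → x HasOrder a → y HasOrder a
  inverse-hasOrder {x} {y} {a} xy≈1 ord = record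
    { order≢0 = order≢0 ord
    ; ^order≈1 = begin
        y ^ a               ≈⟨ *-identityˡ _ ⟨
        1# * y ^ a          ≈⟨ *-congʳ (^order≈1 ord) ⟨
        x ^ a * y ^ a       ≈⟨ ^-*-inverse xy≈1 a ⟩
        1#                  ∎
    ; order∣ = λ {k} y^k≈1 → order∣ ord (begin
        x ^ k               ≈⟨ *-identityʳ _ ⟨
        x ^ k * 1#          ≈⟨ *-congˡ y^k≈1 ⟨
        x ^ k * y ^ k       ≈⟨ ^-*-inverse xy≈1 k ⟩
        1#                  ∎)
    }

  -1^odd≈-1 : ∀ k → (- 1#) ^ suc (k ℕ.* 2) ≈ - 1#
  -1^odd≈-1 k = begin
    - 1# * (- 1#) ^ (k ℕ.* 2)   ≡⟨ ≡.cong (λ n → - 1# * (- 1#) ^ n) (ℕ.*-comm k 2) ⟩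
    - 1# * (- 1#) ^ (2 ℕ.* k)   ≈⟨ *-congˡ (^-assocʳ (- 1#) 2 k) ⟨
    - 1# * ((- 1#) ^ 2) ^ k     ≈⟨ *-congˡ (^-congˡ k [-1]²≈1) ⟩
    - 1# * 1# ^ k               ≈⟨ *-congˡ (1^n≈1 k) ⟩
    - 1# * 1#                   ≈⟨ *-identityʳ (- 1#) ⟩
    - 1#                        ∎
    where
    [-1]²≈1 : (- 1#) ^ 2 ≈ 1#
    [-1]²≈1 = begin
      - 1# * (- 1# * 1#)  ≈⟨ *-congˡ (*-identityʳ (- 1#)) ⟩
      - 1# * - 1#         ≈⟨ -1*x≈-x (- 1#) ⟩
      - (- 1#)            ≈⟨ -‿involutive 1# ⟩
      1#                  ∎

module FieldProperties {c ℓ} (F : CommutativeRing c ℓ) (isField : IsField F) where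
  open CommutativeRing F
  open Powers F
  open import Relation.Binary.Reasoning.Setoid setoid

  0≉1 : 0# ≉ 1#
  0≉1 = proj₁ isField

  *-cancelˡ : ∀ {x y z} → x ≉ 0# → x * y ≈ x * z → y ≈ z
  *-cancelˡ {x} {y} {z} x≉0 xy≈xz with proj₂ isField x x≉0
  ... | x⁻¹ , xx⁻¹≈1 = begin
    y               ≈⟨ *-identityˡ y ⟨
    1# * y          ≈⟨ *-congʳ (trans (*-comm x⁻¹ x) xx⁻¹≈1) ⟨
    x⁻¹ * x * y     ≈⟨ *-assoc x⁻¹ x y ⟩
    x⁻¹ * (x * y)   ≈⟨ *-congˡ xy≈xz ⟩
    x⁻¹ * (x * z)   ≈⟨ *-assoc x⁻¹ x z ⟨
    x⁻¹ * x * z     ≈⟨ *-congʳ (trans (*-comm x⁻¹ x) xx⁻¹≈1) ⟩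
    1# * z          ≈⟨ *-identityˡ z ⟩
    z               ∎

  x*y≈0⇒y≈0 : ∀ {x y} → x ≉ 0# → x * y ≈ 0# → y ≈ 0#
  x*y≈0⇒y≈0 {x} x≉0 xy≈0 = *-cancelˡ x≉0 (trans xy≈0 (sym (zeroʳ x)))

  ^-≉0 : ∀ {x} k → x ≉ 0# → x ^ k ≉ 0#
  ^-≉0 zero    x≉0 1≈0 = 0≉1 (sym 1≈0)
  ^-≉0 (suc k) x≉0 xx^k≈0 = ^-≉0 k x≉0 (x*y≈0⇒y≈0 x≉0 xx^k≈0)

  ^-cancelˡ : ∀ {x} i d → x ≉ 0# → x ^ i ≈ x ^ (i ℕ.+ d) → x ^ d ≈ 1#
  ^-cancelˡ {x} i d x≉0 x^i≈x^i+d = sym (*-cancelˡ (^-≉0 i x≉0) (begin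
    x ^ i * 1#     ≈⟨ *-identityʳ _ ⟩
    x ^ i          ≈⟨ x^i≈x^i+d ⟩
    x ^ (i ℕ.+ d)  ≈⟨ ^-homo-* x i d ⟩
    x ^ i * x ^ d  ∎))

  hasOrder⇒≉0 : ∀ {x a} → x HasOrder a → x ≉ 0#
  hasOrder⇒≉0 {x} {zero}  ord x≈0 = order≢0 ord ≡.refl
  hasOrder⇒≉0 {x} {suc a} ord x≈0 = 0≉1 (begin
    0#           ≈⟨ zeroˡ _ ⟨
    0# * x ^ a   ≈⟨ *-congʳ x≈0 ⟨
    x ^ suc a    ≈⟨ ^order≈1 ord ⟩
    1#           ∎)

  ^-injective-≤ : ∀ {x a i j} → x HasOrder a → i ≤ j → j ℕ.∸ i < a → x ^ i ≈ x ^ j → i ≡ j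
  ^-injective-≤ {x} {a} {i} {j} ord i≤j j∸i<a x^i≈x^j =
    ℕ.≤-antisym i≤j (ℕ.m∸n≡0⇒m≤n (∣∧<⇒≡0 a∣j∸i j∸i<a))
    where
    a∣j∸i : a ∣ j ℕ.∸ i
    a∣j∸i = order∣ ord (^-cancelˡ i (j ℕ.∸ i) (hasOrder⇒≉0 ord)
              (trans x^i≈x^j (reflexive (≡.cong (x ^_) (≡.sym (ℕ.m+[n∸m]≡n i≤j))))))

  ^-injective : ∀ {x a i j} → x HasOrder a → i < a → j < a → x ^ i ≈ x ^ j → i ≡ j
  ^-injective {i = i} {j} ord i<a j<a x^i≈x^j with ℕ.≤-total i j
  ... | inj₁ i≤j = ^-injective-≤ ord i≤j (ℕ.≤-<-trans (ℕ.m∸n≤m j i) j<a) x^i≈x^j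
  ... | inj₂ j≤i = ≡.sym (^-injective-≤ ord j≤i (ℕ.≤-<-trans (ℕ.m∸n≤m i j) i<a) (sym x^i≈x^j))

module MonicPolynomial {c ℓ} (F : CommutativeRing c ℓ) (isField : IsField F) where
  open CommutativeRing F
  open Powers F using (_^_)
  open FieldProperties F isField using (0≉1; x*y≈0⇒y≈0)
  open import Relation.Binary.Reasoning.Setoid setoid
  open import Algebra.Solver.Ring.NaturalCoefficients.Default commutativeSemiring
    using (solve; _:=_; _:+_; _:*_; con)
  open import Data.List.Relation.Unary.Unique.Setoid setoid using (Unique; []; _∷_)

  -- A list of coefficients of length d stands for the monic polynomial
  -- c₀ + c₁ X + ⋯ + c_{d-1} X^{d-1} + X^d.
  eval : List Carrier → Carrier → Carrier
  eval []       x = 1#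
  eval (c ∷ cs) x = c + x * eval cs x

  eval-replicate-0 : ∀ k y → eval (replicate k 0#) y ≈ y ^ k
  eval-replicate-0 zero    y = refl
  eval-replicate-0 (suc k) y = trans (+-identityˡ _) (*-congˡ (eval-replicate-0 k y))

  -- deflate r cs is the quotient of c ∷ cs by X - r, whatever c is.
  deflate : Carrier → List Carrier → List Carrier
  deflate r []       = []
  deflate r (c ∷ cs) = eval (c ∷ cs) r ∷ deflate r cs

  length-deflate : ∀ r cs → length (deflate r cs) ≡ length cs
  length-deflate r []       = ≡.refl
  length-deflate r (c ∷ cs) = ≡.cong suc (length-deflate r cs)

  -- The divisor X - r is passed as d with x ≈ d + r, making the identity a semiring one.
  eval-factor : ∀ {x r d} → x ≈ d + r → ∀ c cs →
                eval (c ∷ cs) x ≈ d * eval (deflate r cs) x + eval (c ∷ cs) r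
  eval-factor {x} {r} {d} x≈d+r c [] = begin
    c + x * 1#               ≈⟨ +-congˡ (*-congʳ x≈d+r) ⟩
    c + (d + r) * 1#         ≈⟨ solve 3 (λ c d r → c :+ (d :+ r) :* con 1
                                                := d :* con 1 :+ (c :+ r :* con 1)) refl c d r ⟩
    d * 1# + (c + r * 1#)    ∎
  eval-factor {x} {r} {d} x≈d+r c (c′ ∷ cs) = begin
    c + x * eval (c′ ∷ cs) x             ≈⟨ +-congˡ (*-cong x≈d+r (eval-factor x≈d+r c′ cs)) ⟩
    c + (d + r) * (d * Q + P)            ≈⟨ solve 5 (λ c d r Q P → c :+ (d :+ r) :* (d :* Q :+ P)
                                              := d :* (P :+ (d :+ r) :* Q) :+ (c :+ r :* P)) refl c d r Q P ⟩
    d * (P + (d + r) * Q) + (c + r * P)  ≈⟨ +-congʳ (*-congˡ (+-congˡ (*-congʳ (sym x≈d+r)))) ⟩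
    d * (P + x * Q) + (c + r * P)        ∎
    where
    Q P : Carrier
    Q = eval (deflate r cs) x
    P = eval (c′ ∷ cs) r

  roots-bound : ∀ cs {rs} → Unique rs → All (λ r → eval cs r ≈ 0#) rs → length rs ≤ length cs
  roots-bound cs       {[]}     _           _                 = z≤n
  roots-bound []       {r ∷ rs} _           (1≈0 ∷ _)         = ⊥-elim (0≉1 (sym 1≈0))
  roots-bound (c ∷ cs) {r ∷ rs} (r∉rs ∷ rs!) (r-root ∷ rs-roots) =
    s≤s (≡.subst (length rs ≤_) (length-deflate r cs)
          (roots-bound (deflate r cs) rs! (All.zipWith root-of-deflation (r∉rs , rs-roots))))
    where
    root-of-deflation : ∀ {s} → r ≉ s × eval (c ∷ cs) s ≈ 0# → eval (deflate r cs) s ≈ 0#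
    root-of-deflation {s} (r≉s , s-root) = x*y≈0⇒y≈0 s-r≉0 (begin
      (s - r) * eval (deflate r cs) s                   ≈⟨ +-identityʳ _ ⟨
      (s - r) * eval (deflate r cs) s + 0#              ≈⟨ +-congˡ r-root ⟨
      (s - r) * eval (deflate r cs) s + eval (c ∷ cs) r ≈⟨ eval-factor s≈[s-r]+r c cs ⟨
      eval (c ∷ cs) s                                   ≈⟨ s-root ⟩
      0#                                                ∎)
      where
      s≈[s-r]+r : s ≈ (s - r) + r
      s≈[s-r]+r = sym (begin
        s + - r + r    ≈⟨ +-assoc s (- r) r ⟩
        s + (- r + r)  ≈⟨ +-congˡ (-‿inverseˡ r) ⟩
        s + 0#         ≈⟨ +-identityʳ s ⟩
        s              ∎)
      s-r≉0 : s - r ≉ 0#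
      s-r≉0 s-r≈0 = r≉s (sym (trans s≈[s-r]+r (trans (+-congʳ s-r≈0) (+-identityˡ r))))

module FiniteField {c ℓ} (F : CommutativeRing c ℓ) (isField : IsField F) {q} (card : HasCard F q) where
  open CommutativeRing F
  open Powers F
  open FieldProperties F isField
  open MonicPolynomial F isField using (eval; eval-replicate-0; roots-bound)
  open Inverse card using (to; from; to-cong; from-cong; strictlyInverseˡ; strictlyInverseʳ)
  open import Relation.Binary.Reasoning.Setoid setoid
  open import Data.List.Relation.Unary.Unique.Setoid setoid using (Unique; _∷_)
  import Data.List.Relation.Unary.Unique.Setoid.Properties as Unique
  open import Algebra.Properties.Ring ring using (-‿injective; -0#≈0#)

  to-injective : ∀ {x y} → to x ≡ to y → x ≈ y
  to-injective {x} {y} tx≡ty =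
    trans (sym (strictlyInverseʳ x)) (trans (from-cong tx≡ty) (strictlyInverseʳ y))

  infix 4 _≟_
  _≟_ : ∀ x y → Dec (x ≈ y)
  x ≟ y = map′ to-injective to-cong (to x Fin.≟ to y)

  private
    lookup-injective : ∀ {xs} → Unique xs → ∀ i j → lookup xs i ≈ lookup xs j → i ≡ j
    lookup-injective (_ ∷ _)     Fin.zero    Fin.zero    _   = ≡.refl
    lookup-injective (x∉xs ∷ _)  Fin.zero    (Fin.suc j) x≈y = ⊥-elim (All.lookup x∉xs (∈-lookup j) x≈y)
    lookup-injective (x∉xs ∷ _)  (Fin.suc i) Fin.zero    y≈x = ⊥-elim (All.lookup x∉xs (∈-lookup i) (sym y≈x))
    lookup-injective (_ ∷ xs!)   (Fin.suc i) (Fin.suc j) e   = ≡.cong Fin.suc (lookup-injective xs! i j e)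

  unique⇒length≤card : ∀ {xs} → Unique xs → length xs ≤ q
  unique⇒length≤card {xs} xs! =
    FinP.injective⇒≤ {f = λ i → to (lookup xs i)} (λ e → lookup-injective xs! _ _ (to-injective e))

  order-from-exponent : ∀ {x} e → 0 < e → x ^ e ≈ 1# → ∃ (x HasOrder_)
  order-from-exponent {x} = <-rec _ least
    where
    least : ∀ e → (∀ {k} → k < e → 0 < k → x ^ k ≈ 1# → ∃ (x HasOrder_)) →
            0 < e → x ^ e ≈ 1# → ∃ (x HasOrder_)
    least e rec 0<e x^e≈1 with ℕ.anyUpTo? (λ k → 0 ℕ.<? k ×-dec x ^ k ≟ 1#) e
    ... | yes (k , k<e , 0<k , x^k≈1) = rec k<e 0<k x^k≈1
    ... | no none = e , record
      { order≢0 = ℕ.>⇒≢ 0<e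
      ; ^order≈1 = x^e≈1
      ; order∣ = e∣
      }
      where
      instance
        _ : NonZero e
        _ = ℕ.>-nonZero 0<e
      e∣ : ∀ {k} → x ^ k ≈ 1# → e ∣ k
      e∣ {k} x^k≈1 with k % e ℕ.≟ 0
      ... | yes k%e≡0 = m%n≡0⇒n∣m k e k%e≡0
      ... | no  k%e≢0 = ⊥-elim (none (k % e , m%n<n k e , ℕ.n≢0⇒n>0 k%e≢0 , x^[k%e]≈1))
        where
        x^[k%e]≈1 : x ^ (k % e) ≈ 1#
        x^[k%e]≈1 = begin
          x ^ (k % e)                              ≈⟨ *-identityʳ _ ⟨
          x ^ (k % e) * 1#                         ≈⟨ *-congˡ (^≈1-∣ x^e≈1 (n∣m*n (k / e))) ⟨
          x ^ (k % e) * x ^ (k / e ℕ.* e)          ≈⟨ ^-homo-* x (k % e) _ ⟨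
          x ^ (k % e ℕ.+ k / e ℕ.* e)              ≡⟨ ≡.cong (x ^_) (m≡m%n+[m/n]*n k e) ⟨
          x ^ k                                    ≈⟨ x^k≈1 ⟩
          1#                                       ∎

  order-exists : ∀ {x} → x ≉ 0# → ∃ (x HasOrder_)
  order-exists {x} x≉0 = from-collision (FinP.pigeonhole (ℕ.n<1+n q) (λ i → to (x ^ Fin.toℕ i)))
    where
    from-collision : (∃₂ λ i j → i Fin.< j × to (x ^ Fin.toℕ i) ≡ to (x ^ Fin.toℕ j)) → ∃ (x HasOrder_)
    from-collision (i , j , i<j , xⁱ≡xʲ) =
      order-from-exponent (Fin.toℕ j ℕ.∸ Fin.toℕ i) (ℕ.m<n⇒0<n∸m i<j)
        (^-cancelˡ (Fin.toℕ i) _ x≉0 (trans (to-injective xⁱ≡xʲ)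
          (reflexive (≡.cong (x ^_) (≡.sym (ℕ.m+[n∸m]≡n (ℕ.<⇒≤ i<j)))))))

  order<card : ∀ {x a} → x HasOrder a → a < q
  order<card {x} {a} ord = ≡.subst (_≤ q) (≡.cong suc (List.length-applyUpTo (x ^_) a))
                             (unique⇒length≤card (0∉powers ∷ powers-unique))
    where
    0∉powers : All (0# ≉_) (applyUpTo (x ^_) a)
    0∉powers = All.applyUpTo⁺₁ (x ^_) a (λ {i} _ 0≈xⁱ → ^-≉0 i (hasOrder⇒≉0 ord) (sym 0≈xⁱ))
    powers-unique : Unique (applyUpTo (x ^_) a)
    powers-unique = AllPairs.applyUpTo⁺₁ (x ^_) a
      (λ i<j j<a xⁱ≈xʲ → ℕ.<⇒≢ i<j (^-injective ord (ℕ.<-trans i<j j<a) j<a xⁱ≈xʲ))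

  card≤1+exponent : ∀ {e} → e ≢ 0 → (∀ {y} → y ≉ 0# → y ^ e ≈ 1#) → q ≤ suc e
  card≤1+exponent {zero}  e≢0 _      = ⊥-elim (e≢0 ≡.refl)
  card≤1+exponent {suc e} _   fermat =
    ≡.subst₂ _≤_ (List.length-tabulate from) (≡.cong (suc ∘ suc) (List.length-replicate e))
      (roots-bound Xᵉ⁺¹-X (Unique.tabulate⁺ setoid from-injective) (All.tabulate⁺ (λ i → root (from i))))
    where
    Xᵉ⁺¹-X : List Carrier
    Xᵉ⁺¹-X = 0# ∷ - 1# ∷ replicate e 0#
    from-injective : ∀ {i j} → from i ≈ from j → i ≡ j
    from-injective {i} {j} e = ≡.trans (≡.sym (strictlyInverseˡ i)) (≡.trans (to-cong e) (strictlyInverseˡ j))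
    root : ∀ y → eval Xᵉ⁺¹-X y ≈ 0#
    root y = begin
      0# + y * (- 1# + y * eval (replicate e 0#) y) ≈⟨ +-identityˡ _ ⟩
      y * (- 1# + y * eval (replicate e 0#) y)      ≈⟨ *-congˡ (+-congˡ (*-congˡ (eval-replicate-0 e y))) ⟩
      y * (- 1# + y ^ suc e)                        ≈⟨ y[-1+yᵉ⁺¹]≈0 (y ≟ 0#) ⟩
      0#                                            ∎
      where
      y[-1+yᵉ⁺¹]≈0 : Dec (y ≈ 0#) → y * (- 1# + y ^ suc e) ≈ 0#
      y[-1+yᵉ⁺¹]≈0 (yes y≈0) = trans (*-congʳ y≈0) (zeroˡ _)
      y[-1+yᵉ⁺¹]≈0 (no  y≉0) = trans (*-congˡ (trans (+-congˡ (fermat y≉0)) (-‿inverseˡ 1#))) (zeroʳ y)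

  private
    Exponent : Set (c ⊔ ℓ)
    Exponent = ∃₂ λ g e → g HasOrder e × (∀ {y} → y ≉ 0# → y ^ e ≈ 1#)

    exponent-above : ∀ d {x a} → x HasOrder a → q ≤ d ℕ.+ a → Exponent
    exponent-above zero ord q≤a = ⊥-elim (ℕ.<⇒≱ (order<card ord) q≤a)
    exponent-above (suc d) {x} {a} ord q≤1+d+a
      with FinP.all? (λ i → from i ≟ 0# ⊎-dec from i ^ a ≟ 1#)
    ... | yes all = x , a , ord , λ {y} y≉0 → [ (λ y≈0 → ⊥-elim (y≉0 (trans (sym (strictlyInverseʳ y)) y≈0)))
                                               , (λ yᵃ≈1 → trans (^-congˡ a (sym (strictlyInverseʳ y))) yᵃ≈1)
                                               ] (all (to y))
    ... | no ¬all =
      let i , bad = FinP.¬∀⟶∃¬ q _ (λ i → from i ≟ 0# ⊎-dec from i ^ a ≟ 1#) ¬all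
          b , y-ord = order-exists (bad ∘ inj₁)
          z , a′ , a<a′ , z-ord = larger-order ord y-ord (bad ∘ inj₂ ∘ ^≈1 y-ord)
      in exponent-above d z-ord (ℕ.≤-trans q≤1+d+a
           (ℕ.≤-trans (ℕ.≤-reflexive (≡.sym (ℕ.+-suc d a))) (ℕ.+-monoʳ-≤ d a<a′)))

    exponent : Exponent
    exponent = exponent-above q 1-hasOrder (ℕ.m≤m+n q 1)

    exponent≡q-1 : ∀ {g e} → g HasOrder e → (∀ {y} → y ≉ 0# → y ^ e ≈ 1#) → e ≡ q ℕ.∸ 1
    exponent≡q-1 ord fermat =
      ≡.cong (ℕ._∸ 1) (ℕ.≤-antisym (order<card ord) (card≤1+exponent (order≢0 ord) fermat))

  primitive-element : ∃ λ g → g HasOrder (q ℕ.∸ 1)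
  primitive-element = let g , e , ord , fermat = exponent in
    g , ≡.subst (g HasOrder_) (exponent≡q-1 ord fermat) ord

  ^[q-1]≈1 : ∀ {y} → y ≉ 0# → y ^ (q ℕ.∸ 1) ≈ 1#
  ^[q-1]≈1 {y} = let g , e , ord , fermat = exponent in
    ≡.subst (λ k → y ^ k ≈ 1#) (exponent≡q-1 ord fermat) ∘ fermat

  even-card⇒1+1≈0 : 2 ∣ q → 1# + 1# ≈ 0#
  even-card⇒1+1≈0 (divides zero q≡0) = ⊥-elim (FinP.¬Fin0 (≡.subst Fin q≡0 (to 0#)))
  even-card⇒1+1≈0 (divides (suc h) q≡2+2h) = begin
    1# + 1#    ≈⟨ +-congˡ -1≈1 ⟨
    1# + - 1#  ≈⟨ -‿inverseʳ 1# ⟩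
    0#         ∎
    where
    -1≉0 : - 1# ≉ 0#
    -1≉0 -1≈0 = 0≉1 (sym (-‿injective (trans -1≈0 (sym -0#≈0#))))
    -1≈1 : - 1# ≈ 1#
    -1≈1 = trans (sym (-1^odd≈-1 h)) (≡.subst (λ k → (- 1#) ^ k ≈ 1#) (≡.cong (ℕ._∸ 1) q≡2+2h) (^[q-1]≈1 -1≉0))

Characteristic2 : ∀ {c ℓ} → CommutativeRing c ℓ → Set ℓ
Characteristic2 F = 1# + 1# ≈ 0#
  where open CommutativeRing F

module ReciprocalSums {c ℓ} (F : CommutativeRing c ℓ) (isField : IsField F) (char2 : Characteristic2 F) where
  open CommutativeRing F
  open FieldProperties F isField using (0≉1; *-cancelˡ)
  open import Relation.Binary.Reasoning.Setoid setoid

  x+x≈0 : ∀ x → x + x ≈ 0#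
  x+x≈0 x = begin
    x + x               ≈⟨ +-cong (*-identityˡ x) (*-identityˡ x) ⟨
    1# * x + 1# * x     ≈⟨ distribʳ x 1# 1# ⟨
    (1# + 1#) * x       ≈⟨ *-congʳ char2 ⟩
    0# * x              ≈⟨ zeroˡ x ⟩
    0#                  ∎

  infix 4 _splits_
  _splits_ : Carrier → Carrier → Set (c ⊔ ℓ)
  x splits z = ∃ λ x′ → x * x′ ≈ 1# × x + x′ ≈ z

  ReciprocalSum : Carrier → Set (c ⊔ ℓ)
  ReciprocalSum z = ∃ (_splits z)

  splits⇒≉0 : ∀ {x z} → x splits z → x ≉ 0#
  splits⇒≉0 (x′ , xx′≈1 , _) x≈0 = 0≉1 (trans (sym (zeroˡ x′)) (trans (*-congʳ (sym x≈0)) xx′≈1))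

  splits-unique : ∀ {x z z′} → x splits z → x splits z′ → z ≈ z′
  splits-unique {x} {z} {z′} x-splits@(a , xa≈1 , x+a≈z) (b , xb≈1 , x+b≈z′) = begin
    z      ≈⟨ x+a≈z ⟨
    x + a  ≈⟨ +-congˡ (*-cancelˡ (splits⇒≉0 x-splits) (trans xa≈1 (sym xb≈1))) ⟩
    x + b  ≈⟨ x+b≈z′ ⟩
    z′     ∎

  splits-resp : ∀ {x y z} → x ≈ y → x splits z → y splits z
  splits-resp x≈y (x′ , xx′≈1 , x+x′≈z) =
    x′ , trans (*-congʳ (sym x≈y)) xx′≈1 , trans (+-congʳ (sym x≈y)) x+x′≈z

  partner-splits : ∀ {x x′ z} → x * x′ ≈ 1# → x + x′ ≈ z → x′ splits z
  partner-splits {x} xx′≈1 x+x′≈z = x , trans (*-comm _ x) xx′≈1 , trans (+-comm _ x) x+x′≈z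

  splits⇒≉1 : ∀ {x z} → z ≉ 0# → x splits z → x ≉ 1#
  splits⇒≉1 {x} {z} z≉0 (x′ , xx′≈1 , x+x′≈z) x≈1 = z≉0 (begin
    z        ≈⟨ x+x′≈z ⟨
    x + x′   ≈⟨ +-cong x≈1 x′≈1 ⟩
    1# + 1#  ≈⟨ char2 ⟩
    0#       ∎)
    where
    x′≈1 : x′ ≈ 1#
    x′≈1 = trans (sym (*-identityˡ x′)) (trans (*-congʳ (sym x≈1)) xx′≈1)

  partner-≉ : ∀ {x x′ z} → z ≉ 0# → x + x′ ≈ z → x ≉ x′
  partner-≉ {x} z≉0 x+x′≈z x≈x′ = z≉0 (trans (sym x+x′≈z) (trans (+-congˡ (sym x≈x′)) (x+x≈0 x)))

module CountingReciprocalSums {c ℓ} (F : CommutativeRing c ℓ) (isField : IsField F)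
                              (char2 : Characteristic2 F) {q} (card : HasCard F q) where
  open CommutativeRing F
  open Powers F
  open ReciprocalSums F isField char2
  open FiniteField F isField card using (_≟_; unique⇒length≤card; primitive-element)
  open FieldProperties F isField using (0≉1; ^-≉0; ^-injective-≤; hasOrder⇒≉0)
  open Inverse card using (to; from; strictlyInverseʳ)
  open import Data.List.Relation.Unary.Unique.Setoid setoid using (Unique; []; _∷_)

  halves : ∀ {zs} → All ReciprocalSum zs → List Carrier
  halves []                  = []
  halves ((s , s′ , _) ∷ rs) = s ∷ s′ ∷ halves rs

  length-halves : ∀ {zs} (rs : All ReciprocalSum zs) → length (halves rs) ≡ length zs ℕ.+ length zs
  length-halves []                    = ≡.refl
  length-halves {_ ∷ zs} (_ ∷ rs) =
    ≡.cong suc (≡.trans (≡.cong suc (length-halves rs)) (≡.sym (ℕ.+-suc (length zs) (length zs))))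

  halves-split : ∀ {p} {P : Carrier → Set p} {zs} → All P zs → (rs : All ReciprocalSum zs) →
                 All (λ x → ∃ λ z → P z × x splits z) (halves rs)
  halves-split [] [] = []
  halves-split {zs = z ∷ _} (pz ∷ ps) ((s , s′ , ss′≈1 , s+s′≈z) ∷ rs) =
    (z , pz , s′ , ss′≈1 , s+s′≈z) ∷ (z , pz , partner-splits ss′≈1 s+s′≈z) ∷ halves-split ps rs

  halves-unique : ∀ {zs} → Unique zs → All (_≉ 0#) zs → (rs : All ReciprocalSum zs) → Unique (halves rs)
  halves-unique [] [] [] = []
  halves-unique {z ∷ _} (z∉zs ∷ zs!) (z≉0 ∷ zs≉0) ((s , s′ , ss′≈1 , s+s′≈z) ∷ rs) =
    (partner-≉ z≉0 s+s′≈z ∷ All.map (apart (s′ , ss′≈1 , s+s′≈z)) others) ∷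
    All.map (apart (partner-splits ss′≈1 s+s′≈z)) others ∷
    halves-unique zs! zs≉0 rs
    where
    others : All (λ y → ∃ λ z′ → z ≉ z′ × y splits z′) (halves rs)
    others = halves-split z∉zs rs
    apart : ∀ {x} → x splits z → ∀ {y} → (∃ λ z′ → z ≉ z′ × y splits z′) → x ≉ y
    apart x-splits (z′ , z≉z′ , y-splits) x≈y = z≉z′ (splits-unique (splits-resp x≈y x-splits) y-splits)

  -- The halves s, s⁻¹ of distinct nonzero reciprocal sums are distinct and differ from 0 and 1.
  reciprocal-sums-bound : ∀ {zs} → Unique zs → All (_≉ 0#) zs → All ReciprocalSum zs →
                          2 ℕ.+ (length zs ℕ.+ length zs) ≤ q
  reciprocal-sums-bound zs! zs≉0 rs =
    ≡.subst (λ n → 2 ℕ.+ n ≤ q) (length-halves rs)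
      (unique⇒length≤card ((0≉1 ∷ All.map (λ (_ , _ , x-splits) → splits⇒≉0 x-splits ∘ sym) split)
                          ∷ All.map (λ (_ , z≉0 , x-splits) → splits⇒≉1 z≉0 x-splits ∘ sym) split
                          ∷ halves-unique zs! zs≉0 rs))
    where
    split : All (λ x → ∃ λ z → z ≉ 0# × x splits z) (halves rs)
    split = halves-split zs≉0 rs

  reciprocalSum? : ∀ z → Dec (ReciprocalSum z)
  reciprocalSum? z = map′ fromFin toFin
    (FinP.any? λ i → FinP.any? λ j → from i * from j ≟ 1# ×-dec from i + from j ≟ z)
    where
    FinWitness : Set ℓ
    FinWitness = ∃₂ λ i j → from i * from j ≈ 1# × from i + from j ≈ z
    fromFin : FinWitness → ReciprocalSum z
    fromFin (i , j , ij≈1 , i+j≈z) = from i , from j , ij≈1 , i+j≈z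
    toFin : ReciprocalSum z → FinWitness
    toFin (s , s′ , ss′≈1 , s+s′≈z) =
      to s , to s′ , trans (*-cong (strictlyInverseʳ s) (strictlyInverseʳ s′)) ss′≈1
                   , trans (+-cong (strictlyInverseʳ s) (strictlyInverseʳ s′)) s+s′≈z

  private
    m : ℕ
    m = q ℕ.∸ 1

    g : Carrier
    g = proj₁ primitive-element

    g-order : g HasOrder m
    g-order = proj₂ primitive-element

    coprimes : List ℕ
    coprimes = filter (λ k → coprime? k m) (map suc (upTo m))

    generators-unique : Unique (map (g ^_) coprimes)
    generators-unique = AllPairs.map⁺ (AllPairs.filter⁺ (λ k → coprime? k m) (AllPairs.map⁺
      (AllPairs.applyUpTo⁺₁ (λ i → i) m (λ {i} {j} i<j j<m e →
        ℕ.<⇒≢ (s≤s i<j) (^-injective-≤ g-order (s≤s (ℕ.<⇒≤ i<j)) (ℕ.≤-<-trans (ℕ.m∸n≤m j i) j<m) e)))))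

    generators-≉0 : All (_≉ 0#) (map (g ^_) coprimes)
    generators-≉0 = All.map⁺ (All.universal (λ k → ^-≉0 k (hasOrder⇒≉0 g-order)) coprimes)

  non-reciprocal-generator : q ≤ 2 ℕ.* totient (q ℕ.∸ 1) → ∃ λ t → t HasOrder (q ℕ.∸ 1) × ¬ ReciprocalSum t
  non-reciprocal-generator q≤2φ = decide (All.all? (reciprocalSum? ∘ (g ^_)) coprimes)
    where
    decide : Dec (All (ReciprocalSum ∘ (g ^_)) coprimes) → ∃ λ t → t HasOrder m × ¬ ReciprocalSum t
    decide (yes all) = ⊥-elim (ℕ.m+1+n≰m (totient m ℕ.+ totient m) (begin
      totient m ℕ.+ totient m ℕ.+ 2    ≡⟨ ℕ.+-comm _ 2 ⟩
      2 ℕ.+ (totient m ℕ.+ totient m)  ≡⟨ ≡.cong (λ n → 2 ℕ.+ (n ℕ.+ n)) (List.length-map (g ^_) coprimes) ⟨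
      2 ℕ.+ (length zs ℕ.+ length zs)  ≤⟨ reciprocal-sums-bound generators-unique generators-≉0 (All.map⁺ all) ⟩
      q                                ≤⟨ q≤2φ ⟩
      2 ℕ.* totient m                  ≡⟨ ≡.cong (totient m ℕ.+_) (ℕ.+-identityʳ (totient m)) ⟩
      totient m ℕ.+ totient m          ∎))
      where
      open ℕ.≤-Reasoning
      zs : List Carrier
      zs = map (g ^_) coprimes
    decide (no ¬all) =
      let k⊥m , ¬rs = All.lookupAny (All.all-filter (λ k → coprime? k m) (map suc (upTo m)))
                                    (All.¬All⇒Any¬ (reciprocalSum? ∘ (g ^_)) coprimes ¬all)
      in _ , ^-coprime-hasOrder g-order k⊥m , ¬rs

module MatrixProducts {c ℓ} (R : CommutativeRing c ℓ) where
  open CommutativeRing R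
  open import Algebra.Solver.Ring.NaturalCoefficients.Default commutativeSemiring
    using (solve; _:=_; _:+_; _:*_; con)
  open import Algebra.Properties.Ring ring using (-1*x≈-x; -‿involutive; -‿injective)

  infixl 7 _·_
  _·_ : Mat R → Mat R → Mat R
  _·_ = _⊗_ R

  infix 4 _≋_
  _≋_ : Mat R → Mat R → Set ℓ
  _≋_ = _≈M_ R

  ≋-isEquivalence : IsEquivalence _≋_
  ≋-isEquivalence = record
    { refl  = refl , refl , refl , refl
    ; sym   = λ (a , b , c , d) → sym a , sym b , sym c , sym d
    ; trans = λ (a , b , c , d) (a′ , b′ , c′ , d′) → trans a a′ , trans b b′ , trans c c′ , trans d d′
    }

  ≋-setoid : Setoid c ℓ
  ≋-setoid = record { isEquivalence = ≋-isEquivalence }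

  open IsEquivalence ≋-isEquivalence public using () renaming (refl to ≋-refl; sym to ≋-sym; trans to ≋-trans)

  ·-cong : ∀ {A A′ B B′} → A ≋ A′ → B ≋ B′ → A · B ≋ A′ · B′
  ·-cong (a , b , c , d) (e , f , g , h) =
    +-cong (*-cong a e) (*-cong b g) , +-cong (*-cong a f) (*-cong b h) ,
    +-cong (*-cong c e) (*-cong d g) , +-cong (*-cong c f) (*-cong d h)

  ·-assoc : ∀ A B C → (A · B) · C ≋ A · (B · C)
  ·-assoc (mat a b c d) (mat e f g h) (mat i j k l) =
    entry a b i k , entry a b j l , entry c d i k , entry c d j l
    where
    entry : ∀ a b i k → (a * e + b * g) * i + (a * f + b * h) * k ≈ a * (e * i + f * k) + b * (g * i + h * k)
    entry = solve 8 (λ e f g h a b i k → (a :* e :+ b :* g) :* i :+ (a :* f :+ b :* h) :* k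
                                         := a :* (e :* i :+ f :* k) :+ b :* (g :* i :+ h :* k)) refl e f g h

  ·-identityˡ : ∀ A → IdM R · A ≋ A
  ·-identityˡ (mat a b c d) = entry a c , entry b d , entry′ a c , entry′ b d
    where
    entry : ∀ a c → 1# * a + 0# * c ≈ a
    entry = solve 2 (λ a c → con 1 :* a :+ con 0 :* c := a) refl
    entry′ : ∀ a c → 0# * a + 1# * c ≈ c
    entry′ = solve 2 (λ a c → con 0 :* a :+ con 1 :* c := c) refl

  ·-identityʳ : ∀ A → A · IdM R ≋ A
  ·-identityʳ (mat a b c d) = entry a b , entry′ a b , entry c d , entry′ c d
    where
    entry : ∀ a b → a * 1# + b * 0# ≈ a
    entry = solve 2 (λ a b → a :* con 1 :+ b :* con 0 := a) refl
    entry′ : ∀ a b → a * 0# + b * 1# ≈ b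
    entry′ = solve 2 (λ a b → a :* con 0 :+ b :* con 1 := b) refl

  private
    step : Mat R → Carrier → Mat R
    step acc a = elemM R a · acc

    foldl-cong : ∀ {A B xs ys} → A ≋ B → Pointwise _≈_ xs ys → foldl step A xs ≋ foldl step B ys
    foldl-cong A≋B []             = A≋B
    foldl-cong A≋B (x≈y ∷ xs≈ys) = foldl-cong (·-cong (x≈y , refl , refl , refl) A≋B) xs≈ys

    foldl-step : ∀ xs A → foldl step A xs ≋ Mn R xs · A
    foldl-step []       A = ≋-sym (·-identityˡ A)
    foldl-step (x ∷ xs) A = begin
      foldl step (elemM R x · A) xs         ≈⟨ foldl-step xs (elemM R x · A) ⟩
      Mn R xs · (elemM R x · A)             ≈⟨ ·-cong ≋-refl (·-cong (·-identityʳ (elemM R x)) ≋-refl) ⟨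
      Mn R xs · (elemM R x · IdM R · A)     ≈⟨ ·-assoc (Mn R xs) _ A ⟨
      Mn R xs · (elemM R x · IdM R) · A     ≈⟨ ·-cong (foldl-step xs (elemM R x · IdM R)) ≋-refl ⟨
      Mn R (x ∷ xs) · A                     ∎
      where open import Relation.Binary.Reasoning.Setoid ≋-setoid

  Mn-cong : ∀ {xs ys} → Pointwise _≈_ xs ys → Mn R xs ≋ Mn R ys
  Mn-cong = foldl-cong ≋-refl

  Mn-++ : ∀ xs ys → Mn R (xs ++ ys) ≋ Mn R ys · Mn R xs
  Mn-++ xs ys = ≡.subst (_≋ Mn R ys · Mn R xs) (≡.sym (List.foldl-++ step (IdM R) xs ys)) (foldl-step ys (Mn R xs))

  Mn-∷ : ∀ x xs → Mn R (x ∷ xs) ≋ Mn R xs · elemM R x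
  Mn-∷ x xs = ≋-trans (Mn-++ (x ∷ []) xs) (·-cong ≋-refl (·-identityʳ (elemM R x)))

  private
    m22[EPE]≈-m11[P] : ∀ z P b → Mat.m22 (elemM R z · P · elemM R b) ≈ - Mat.m11 P
    m22[EPE]≈-m11[P] z (mat p q r s) b = trans (entry p q r s (- 1#)) (trans (*-comm p (- 1#)) (-1*x≈-x p))
      where
      entry : ∀ p q r s n → (1# * p + 0# * r) * n + (1# * q + 0# * s) * 0# ≈ p * n
      entry = solve 5 (λ p q r s n → (con 1 :* p :+ con 0 :* r) :* n :+ (con 1 :* q :+ con 0 :* s) :* con 0
                                     := p :* n) refl

    m22≈-m11 : ∀ b w z → Mat.m22 (Mn R (b ∷ w ++ z ∷ [])) ≈ - Mat.m11 (Mn R w)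
    m22≈-m11 b w z = trans (proj₂ (proj₂ (proj₂ sandwich))) (m22[EPE]≈-m11[P] z (Mn R w) b)
      where
      sandwich : Mn R (b ∷ w ++ z ∷ []) ≋ elemM R z · Mn R w · elemM R b
      sandwich = ≋-trans (Mn-∷ b (w ++ z ∷ []))
        (·-cong (≋-trans (Mn-++ w (z ∷ [])) (·-cong (·-identityʳ (elemM R z)) ≋-refl)) ≋-refl)

  quiddity⇒inner-m11≈±1 : ∀ b w z → IsQuiddity R (b ∷ w ++ z ∷ []) →
                           Mat.m11 (Mn R w) ≈ 1# ⊎ Mat.m11 (Mn R w) ≈ - 1#
  quiddity⇒inner-m11≈±1 b w z (inj₁ (_ , _ , _ , m22≈1))  =
    inj₂ (trans (sym (-‿involutive _)) (-‿cong (trans (sym (m22≈-m11 b w z)) m22≈1)))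
  quiddity⇒inner-m11≈±1 b w z (inj₂ (_ , _ , _ , m22≈-1)) =
    inj₁ (-‿injective (trans (sym (m22≈-m11 b w z)) m22≈-1))


module TupleSums {c ℓ} (R : CommutativeRing c ℓ) where

  length-addLast : ∀ b xs → length (addLast R b xs) ≡ length xs
  length-addLast b []           = ≡.refl
  length-addLast b (x ∷ [])     = ≡.refl
  length-addLast b (x ∷ y ∷ ys) = ≡.cong suc (length-addLast b (y ∷ ys))

  length-dropLast : ∀ y ys → length (dropLast R (y ∷ ys)) ≡ length ys
  length-dropLast y []       = ≡.refl
  length-dropLast y (z ∷ ys) = ≡.cong suc (length-dropLast z ys)

  dropLast-++-lastOr : ∀ y ys → y ∷ ys ≡ dropLast R (y ∷ ys) ++ lastOr R y ys ∷ []
  dropLast-++-lastOr y []       = ≡.refl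
  dropLast-++-lastOr y (z ∷ ys) = ≡.cong (y ∷_) (dropLast-++-lastOr z ys)

  ⊕-decomposition : ∀ as bs → 3 ≤ length as → 3 ≤ length bs →
    ∃₂ λ pre w → ∃₂ λ b z → _⊕_ R as bs ≡ pre ++ w × bs ≡ b ∷ w ++ z ∷ [] × 3 ≤ length pre × 1 ≤ length w
  ⊕-decomposition (a ∷ as) (b ∷ b₁ ∷ bs) 3≤|as| (s≤s (s≤s 1≤|bs|)) =
    _ ∷ addLast R b as , dropLast R (b₁ ∷ bs) , b , lastOr R b₁ bs ,
    ≡.refl , ≡.cong (b ∷_) (dropLast-++-lastOr b₁ bs) ,
    ≡.subst (λ n → 3 ≤ suc n) (≡.sym (length-addLast b as)) 3≤|as| ,
    ≡.subst (1 ≤_) (≡.sym (length-dropLast b₁ bs)) 1≤|bs|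

Pointwise-drop : ∀ {a r} {A : Set a} {R : A → A → Set r} xs ys (zs : List A) →
                 Pointwise R xs (ys ++ zs) → Pointwise R (drop (length ys) xs) zs
Pointwise-drop xs       []       zs xs≈zs            = xs≈zs
Pointwise-drop (x ∷ xs) (y ∷ ys) zs (_ ∷ xs≈ys++zs) = Pointwise-drop xs ys zs xs≈ys++zs

module RepeatedTriples {a} {A : Set a} where

  repeat₃ : A → A → A → ℕ → List A
  repeat₃ x y z zero    = []
  repeat₃ x y z (suc j) = x ∷ y ∷ z ∷ repeat₃ x y z j

  length-repeat₃ : ∀ x y z j → length (repeat₃ x y z j) ≡ j ℕ.* 3
  length-repeat₃ x y z zero    = ≡.refl
  length-repeat₃ x y z (suc j) = ≡.cong (suc ∘ suc ∘ suc) (length-repeat₃ x y z j)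

  repeat₃-∷ʳ : ∀ x y z j → repeat₃ x y z j ++ x ∷ [] ≡ x ∷ repeat₃ y z x j
  repeat₃-∷ʳ x y z zero    = ≡.refl
  repeat₃-∷ʳ x y z (suc j) = ≡.cong (λ w → x ∷ y ∷ z ∷ w) (repeat₃-∷ʳ x y z j)

  repeat₃-++ : ∀ x y z j → repeat₃ x y z j ++ x ∷ y ∷ z ∷ [] ≡ repeat₃ x y z (suc j)
  repeat₃-++ x y z zero    = ≡.refl
  repeat₃-++ x y z (suc j) = ≡.cong (λ w → x ∷ y ∷ z ∷ w) (repeat₃-++ x y z j)

  reverse-repeat₃ : ∀ x y z j → reverse (repeat₃ x y z j) ≡ repeat₃ z y x j
  reverse-repeat₃ x y z zero    = ≡.refl
  reverse-repeat₃ x y z (suc j) = begin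
    reverse (x ∷ y ∷ z ∷ [] ++ repeat₃ x y z j)  ≡⟨ List.reverse-++ (x ∷ y ∷ z ∷ []) (repeat₃ x y z j) ⟩
    reverse (repeat₃ x y z j) ++ z ∷ y ∷ x ∷ []  ≡⟨ ≡.cong (_++ z ∷ y ∷ x ∷ []) (reverse-repeat₃ x y z j) ⟩
    repeat₃ z y x j ++ z ∷ y ∷ x ∷ []            ≡⟨ repeat₃-++ z y x j ⟩
    repeat₃ z y x (suc j)                        ∎
    where open ≡.≡-Reasoning

  data Rotation (x y z : A) : A → A → A → Set a where
    rot₀ : Rotation x y z x y z
    rot₁ : Rotation x y z y z x
    rot₂ : Rotation x y z z x y

  Rotation-shift : ∀ {x y z a b c} → Rotation y z x a b c → Rotation x y z a b c
  Rotation-shift rot₀ = rot₁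
  Rotation-shift rot₁ = rot₂
  Rotation-shift rot₂ = rot₀

  private
    drop-++ : ∀ k (xs ys : List A) → k ≤ length xs → drop k (xs ++ ys) ≡ drop k xs ++ ys
    drop-++ zero    xs       ys _         = ≡.refl
    drop-++ (suc k) (x ∷ xs) ys (s≤s k≤n) = drop-++ k xs ys k≤n

    take-++ : ∀ k (xs ys : List A) → k ≤ length xs → take k (xs ++ ys) ≡ take k xs
    take-++ zero    xs       ys _         = ≡.refl
    take-++ (suc k) (x ∷ xs) ys (s≤s k≤n) = ≡.cong (x ∷_) (take-++ k xs ys k≤n)

    rotate-suc : ∀ k x (xs : List A) → k ≤ length xs →
                 drop k xs ++ x ∷ take k xs ≡ drop k (xs ++ x ∷ []) ++ take k (xs ++ x ∷ [])
    rotate-suc k x xs k≤n = ≡.trans (≡.sym (List.++-assoc (drop k xs) (x ∷ []) (take k xs)))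
      (≡.cong₂ _++_ (≡.sym (drop-++ k xs (x ∷ []) k≤n)) (≡.sym (take-++ k xs (x ∷ []) k≤n)))

  rotate-repeat₃ : ∀ k j {x y z} → k ≤ j ℕ.* 3 → ∃₂ λ a b → ∃ λ c →
    Rotation x y z a b c × drop k (repeat₃ x y z j) ++ take k (repeat₃ x y z j) ≡ repeat₃ a b c j
  rotate-repeat₃ zero    j       {x} {y} {z} _ = x , y , z , rot₀ , List.++-identityʳ (repeat₃ x y z j)
  rotate-repeat₃ (suc k) (suc j) {x} {y} {z} (s≤s k≤3j+2) =
    let a , b , c , r , eq = rotate-repeat₃ k (suc j) {y} {z} {x} (ℕ.m≤n⇒m≤1+n k≤3j+2)
    in a , b , c , Rotation-shift r , ≡.trans (rotate-suc k x (y ∷ z ∷ repeat₃ x y z j) k≤|yzR|)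
                                        (≡.trans (≡.cong (λ w → drop k w ++ take k w) yzR++x) eq)
    where
    k≤|yzR| : k ≤ length (y ∷ z ∷ repeat₃ x y z j)
    k≤|yzR| = ≡.subst (λ n → k ≤ suc (suc n)) (≡.sym (length-repeat₃ x y z j)) k≤3j+2
    yzR++x : (y ∷ z ∷ repeat₃ x y z j) ++ x ∷ [] ≡ repeat₃ y z x (suc j)
    yzR++x = ≡.cong (λ w → y ∷ z ∷ w) (repeat₃-∷ʳ x y z j)

  data NonemptySuffix (x y z : A) (i : ℕ) : List A → Set a where
    blocks    : NonemptySuffix x y z i (repeat₃ x y z (suc i))
    blocks+1  : NonemptySuffix x y z i (z ∷ repeat₃ x y z i)
    blocks+2  : NonemptySuffix x y z i (y ∷ z ∷ repeat₃ x y z i)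

  drop-repeat₃ : ∀ x y z P j → P < j ℕ.* 3 → ∃ λ i → i < j × NonemptySuffix x y z i (drop P (repeat₃ x y z j))
  drop-repeat₃ x y z 0 (suc j) _ = j , ℕ.≤-refl , blocks
  drop-repeat₃ x y z 1 (suc j) _ = j , ℕ.≤-refl , blocks+2
  drop-repeat₃ x y z 2 (suc j) _ = j , ℕ.≤-refl , blocks+1
  drop-repeat₃ x y z (suc (suc (suc P))) (suc j) (s≤s (s≤s (s≤s P<3j))) =
    let i , i<j , suffix = drop-repeat₃ x y z P j P<3j in i , ℕ.m≤n⇒m≤1+n i<j , suffix

  drop-repeat₃-≥3 : ∀ x y z P j → 3 ≤ P → P < j ℕ.* 3 →
                    ∃ λ i → suc i < j × NonemptySuffix x y z i (drop P (repeat₃ x y z j))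
  drop-repeat₃-≥3 x y z (suc (suc (suc P))) (suc j) (s≤s (s≤s (s≤s _))) (s≤s (s≤s (s≤s P<3j))) =
    let i , i<j , suffix = drop-repeat₃ x y z P j P<3j in i , s≤s i<j , suffix

module Characteristic2Quiddities {c ℓ} (F : CommutativeRing c ℓ) (char2 : Characteristic2 F) where
  open CommutativeRing F
  open Powers F
  open MatrixProducts F
  open import Algebra.Solver.Ring.AlmostCommutativeRing
    using (fromCommutativeSemiring; _-Raw-AlmostCommutative⟶_)

  private
    F₂ : RawRing _ _
    F₂ = CommutativeRing.rawRing xor-∧-commutativeRing

    ⟦_⟧ : Bool → Carrier
    ⟦ false ⟧ = 0#
    ⟦ true  ⟧ = 1#

    F₂⟶F : F₂ -Raw-AlmostCommutative⟶ fromCommutativeSemiring commutativeSemiring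
    F₂⟶F = record
      { ⟦_⟧    = ⟦_⟧
      ; +-homo = +-homo
      ; *-homo = *-homo
      ; -‿homo = λ _ → refl
      ; 0-homo = refl
      ; 1-homo = refl
      }
      where
      +-homo : ∀ a b → ⟦ a xor b ⟧ ≈ ⟦ a ⟧ + ⟦ b ⟧
      +-homo true  true  = sym char2
      +-homo true  false = sym (+-identityʳ 1#)
      +-homo false b     = sym (+-identityˡ ⟦ b ⟧)
      *-homo : ∀ a b → ⟦ a ∧ b ⟧ ≈ ⟦ a ⟧ * ⟦ b ⟧
      *-homo true  true  = sym (*-identityʳ 1#)
      *-homo true  false = sym (zeroʳ 1#)
      *-homo false b     = sym (zeroˡ ⟦ b ⟧)

    ⟦⟧-≟ : ∀ a b → Maybe (⟦ a ⟧ ≈ ⟦ b ⟧)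
    ⟦⟧-≟ true  true  = just refl
    ⟦⟧-≟ false false = just refl
    ⟦⟧-≟ _     _     = nothing

  -- A ring solver with coefficients in F₂, valid because F has characteristic 2.
  open import Algebra.Solver.Ring F₂ (fromCommutativeSemiring commutativeSemiring) F₂⟶F ⟦⟧-≟
    using (Polynomial; solve; _:=_; _:+_; _:*_; con)

  private
    𝟘 𝟙 : ∀ {n} → Polynomial n
    𝟘 = con false
    𝟙 = con true

  -1≈1 : - 1# ≈ 1#
  -1≈1 = begin
    - 1#               ≈⟨ +-identityʳ _ ⟨
    - 1# + 0#          ≈⟨ +-congˡ char2 ⟨
    - 1# + (1# + 1#)   ≈⟨ +-assoc _ _ _ ⟨
    - 1# + 1# + 1#     ≈⟨ +-congʳ (-‿inverseˡ 1#) ⟩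
    0# + 1#            ≈⟨ +-identityˡ 1# ⟩
    1#                 ∎
    where open import Relation.Binary.Reasoning.Setoid setoid

  inner-m11≈1 : ∀ b w z → IsQuiddity F (b ∷ w ++ z ∷ []) → Mat.m11 (Mn F w) ≈ 1#
  inner-m11≈1 b w z quiddity = [ (λ m11≈1 → m11≈1) , (λ m11≈-1 → trans m11≈-1 -1≈1) ]
                                 (quiddity⇒inner-m11≈±1 b w z quiddity)

  -- P ◃ x = P · elemM x, as elemM x = (x 1 ; 1 0) in characteristic 2.
  infixl 7 _◃_
  _◃_ : Mat F → Carrier → Mat F
  mat p q r s ◃ x = mat (p * x + q) p (r * x + s) r

  ◃-cong : ∀ {A B} x → A ≋ B → A ◃ x ≋ B ◃ x
  ◃-cong x (a , b , c , d) = +-cong (*-congʳ a) b , a , +-cong (*-congʳ c) d , c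

  Mn-∷◃ : ∀ x xs → Mn F (x ∷ xs) ≋ Mn F xs ◃ x
  Mn-∷◃ x xs = ≋-trans (Mn-∷ x xs) (·elemM (Mn F xs))
    where
    ·elemM : ∀ P → P · elemM F x ≋ P ◃ x
    ·elemM (mat p q r s) = col₁ p q , col₂ p q , col₁ r s , col₂ r s
      where
      col₁ : ∀ p q → p * x + q * 1# ≈ p * x + q
      col₁ p q = solve 3 (λ p q x → p :* x :+ q :* 𝟙 := p :* x :+ q) refl p q x
      col₂ : ∀ p q → p * - 1# + q * 0# ≈ p
      col₂ p q = trans (+-congʳ (*-congˡ -1≈1)) (solve 2 (λ p q → p :* 𝟙 :+ q :* 𝟘 := p) refl p q)

  module RepeatedUUT {t u : Carrier} (tu≈1 : t * u ≈ 1#) where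
    open RepeatedTriples {A = Carrier}

    private
      ≈-mod-ut+1 : ∀ {L R W} → L ≈ R + (u * t + 1#) * W → L ≈ R
      ≈-mod-ut+1 {L} {R} {W} L≈ = begin
        L                        ≈⟨ L≈ ⟩
        R + (u * t + 1#) * W     ≈⟨ +-congˡ (*-congʳ (trans (+-congʳ (trans (*-comm u t) tu≈1)) char2)) ⟩
        R + 0# * W               ≈⟨ +-congˡ (zeroˡ W) ⟩
        R + 0#                   ≈⟨ +-identityʳ R ⟩
        R                        ∎
        where open import Relation.Binary.Reasoning.Setoid setoid

      u*1+u*1≈0 : u * 1# + u * 1# ≈ 0#
      u*1+u*1≈0 = solve 1 (λ u → u :* 𝟙 :+ u :* 𝟙 := 𝟘) refl u

    -- M(x, y, z)ʲ for the three rotations (x, y, z) of (u, u, t), using t u = 1 and 1 + 1 = 0.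
    Power : ∀ {x y z} → Rotation u u t x y z → ℕ → Mat F
    Power rot₀ j = mat (t ^ j) 0# (u * t ^ j + u * u ^ j) (u ^ j)
    Power rot₁ j = mat (u ^ j) 0# 0# (t ^ j)
    Power rot₂ j = mat (t ^ j) (u * t ^ j + u * u ^ j) 0# (u ^ j)

    -- Each entry is an identity over F₂[t, u, tʲ, uʲ] modulo u t + 1.
    Power-suc : ∀ {x y z} (r : Rotation u u t x y z) j → Power r j ◃ z ◃ y ◃ x ≋ Power r (suc j)
    Power-suc rot₀ j =
      ≈-mod-ut+1 (solve 4 (λ t u T U →
        ((T :* t :+ 𝟘) :* u :+ T) :* u :+ (T :* t :+ 𝟘)
        := t :* T :+ (u :* t :+ 𝟙) :* (u :* T)) refl t u (t ^ j) (u ^ j)) ,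
      ≈-mod-ut+1 (solve 4 (λ t u T U →
        (T :* t :+ 𝟘) :* u :+ T
        := 𝟘 :+ (u :* t :+ 𝟙) :* T) refl t u (t ^ j) (u ^ j)) ,
      ≈-mod-ut+1 (solve 4 (λ t u T U →
        (((u :* T :+ u :* U) :* t :+ U) :* u :+ (u :* T :+ u :* U)) :* u :+ ((u :* T :+ u :* U) :* t :+ U)
        := u :* (t :* T) :+ u :* (u :* U) :+ (u :* t :+ 𝟙) :* (U :+ u :* u :* U :+ u :* u :* T))
        refl t u (t ^ j) (u ^ j)) ,
      ≈-mod-ut+1 (solve 4 (λ t u T U →
        ((u :* T :+ u :* U) :* t :+ U) :* u :+ (u :* T :+ u :* U)
        := u :* U :+ (u :* t :+ 𝟙) :* (u :* U :+ u :* T)) refl t u (t ^ j) (u ^ j))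
    Power-suc rot₁ j =
      ≈-mod-ut+1 (solve 4 (λ t u T U →
        ((U :* u :+ 𝟘) :* t :+ U) :* u :+ (U :* u :+ 𝟘)
        := u :* U :+ (u :* t :+ 𝟙) :* (u :* U)) refl t u (t ^ j) (u ^ j)) ,
      ≈-mod-ut+1 (solve 4 (λ t u T U →
        (U :* u :+ 𝟘) :* t :+ U
        := 𝟘 :+ (u :* t :+ 𝟙) :* U) refl t u (t ^ j) (u ^ j)) ,
      ≈-mod-ut+1 (solve 4 (λ t u T U →
        ((𝟘 :* u :+ T) :* t :+ 𝟘) :* u :+ (𝟘 :* u :+ T)
        := 𝟘 :+ (u :* t :+ 𝟙) :* T) refl t u (t ^ j) (u ^ j)) ,
      solve 4 (λ t u T U →
        (𝟘 :* u :+ T) :* t :+ 𝟘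
        := t :* T) refl t u (t ^ j) (u ^ j)
    Power-suc rot₂ j =
      ≈-mod-ut+1 (solve 4 (λ t u T U →
        ((T :* u :+ (u :* T :+ u :* U)) :* u :+ T) :* t :+ (T :* u :+ (u :* T :+ u :* U))
        := t :* T :+ (u :* t :+ 𝟙) :* (u :* U)) refl t u (t ^ j) (u ^ j)) ,
      ≈-mod-ut+1 (solve 4 (λ t u T U →
        (T :* u :+ (u :* T :+ u :* U)) :* u :+ T
        := u :* (t :* T) :+ u :* (u :* U) :+ (u :* t :+ 𝟙) :* T) refl t u (t ^ j) (u ^ j)) ,
      ≈-mod-ut+1 (solve 4 (λ t u T U →
        ((𝟘 :* u :+ U) :* u :+ 𝟘) :* t :+ (𝟘 :* u :+ U)
        := 𝟘 :+ (u :* t :+ 𝟙) :* U) refl t u (t ^ j) (u ^ j)) ,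
      solve 4 (λ t u T U →
        (𝟘 :* u :+ U) :* u :+ 𝟘
        := u :* U) refl t u (t ^ j) (u ^ j)

    Mn-repeat₃ : ∀ {x y z} (r : Rotation u u t x y z) j → Mn F (repeat₃ x y z j) ≋ Power r j
    Mn-repeat₃ rot₀ zero = refl , refl , sym u*1+u*1≈0 , refl
    Mn-repeat₃ rot₁ zero = ≋-refl
    Mn-repeat₃ rot₂ zero = refl , sym u*1+u*1≈0 , refl , refl
    Mn-repeat₃ {x} {y} {z} r (suc j) = begin
      Mn F (x ∷ y ∷ z ∷ repeat₃ x y z j)           ≈⟨ Mn-∷◃ x (y ∷ z ∷ repeat₃ x y z j) ⟩
      Mn F (y ∷ z ∷ repeat₃ x y z j) ◃ x           ≈⟨ ◃-cong x (Mn-∷◃ y (z ∷ repeat₃ x y z j)) ⟩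
      Mn F (z ∷ repeat₃ x y z j) ◃ y ◃ x           ≈⟨ ◃-cong x (◃-cong y (Mn-∷◃ z (repeat₃ x y z j))) ⟩
      Mn F (repeat₃ x y z j) ◃ z ◃ y ◃ x           ≈⟨ ◃-cong x (◃-cong y (◃-cong z (Mn-repeat₃ r j))) ⟩
      Power r j ◃ z ◃ y ◃ x                        ≈⟨ Power-suc r j ⟩
      Power r (suc j)                              ∎
      where open import Relation.Binary.Reasoning.Setoid ≋-setoid

    module _ (isField : IsField F) {m} (t-order : t HasOrder m)
             (t-nonreciprocal : ¬ ReciprocalSums.ReciprocalSum F isField char2 t) where
      open FieldProperties F isField using (0≉1)
      open TupleSums F using (⊕-decomposition)

      private
        u-order : u HasOrder m
        u-order = inverse-hasOrder tu≈1 t-order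

        blocks-m11≉1 : ∀ {x y z i} (r : Rotation u u t x y z) → suc i < m →
                       Mat.m11 (Power r (suc i)) ≉ 1#
        blocks-m11≉1 rot₀ 1+i<m = ^≉1-below-order t-order (s≤s z≤n) 1+i<m
        blocks-m11≉1 rot₁ 1+i<m = ^≉1-below-order u-order (s≤s z≤n) 1+i<m
        blocks-m11≉1 rot₂ 1+i<m = ^≉1-below-order t-order (s≤s z≤n) 1+i<m

        blocks+1-m11≉1 : ∀ {x y z i} (r : Rotation u u t x y z) → suc i < m →
                         Mat.m11 (Power r i ◃ z) ≉ 1#
        blocks+1-m11≉1 {i = i} rot₀ 1+i<m m11≈1 = ^≉1-below-order t-order (s≤s z≤n) 1+i<m
          (trans (sym (solve 2 (λ t T → T :* t :+ 𝟘 := t :* T) refl t (t ^ i))) m11≈1)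
        blocks+1-m11≉1 {i = i} rot₁ 1+i<m m11≈1 = ^≉1-below-order u-order (s≤s z≤n) 1+i<m
          (trans (sym (solve 2 (λ u U → U :* u :+ 𝟘 := u :* U) refl u (u ^ i))) m11≈1)
        blocks+1-m11≉1 {i = i} rot₂ 1+i<m m11≈1 = ^≉1-below-order u-order (s≤s z≤n) 1+i<m
          (trans (sym (solve 3 (λ u T U → T :* u :+ (u :* T :+ u :* U) := u :* U) refl u (t ^ i) (u ^ i)))
                 m11≈1)

        blocks+2-m11≉1 : ∀ {x y z i} (r : Rotation u u t x y z) → Mat.m11 (Power r i ◃ z ◃ y) ≉ 1#
        blocks+2-m11≉1 {i = i} rot₀ m11≈1 = 0≉1 (trans (sym (≈-mod-ut+1 (solve 4 (λ t u T U →
          (T :* t :+ 𝟘) :* u :+ T := 𝟘 :+ (u :* t :+ 𝟙) :* T) refl t u (t ^ i) (u ^ i)))) m11≈1)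
        blocks+2-m11≉1 {i = i} rot₁ m11≈1 = 0≉1 (trans (sym (≈-mod-ut+1 (solve 4 (λ t u T U →
          (U :* u :+ 𝟘) :* t :+ U := 𝟘 :+ (u :* t :+ 𝟙) :* U) refl t u (t ^ i) (u ^ i)))) m11≈1)
        blocks+2-m11≉1 {i = i} rot₂ m11≈1 =
          t-nonreciprocal (t ^ suc i , u ^ suc i , ^-*-inverse tu≈1 (suc i) , tⁱ⁺¹+uⁱ⁺¹≈t)
          where
          open import Relation.Binary.Reasoning.Setoid setoid
          tⁱ⁺¹+uⁱ⁺¹≈t : t ^ suc i + u ^ suc i ≈ t
          tⁱ⁺¹+uⁱ⁺¹≈t = begin
            t * t ^ i + u * u ^ i               ≈⟨ t*m11≈ ⟨
            t * Mat.m11 (Power rot₂ i ◃ u ◃ u)  ≈⟨ *-congˡ m11≈1 ⟩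
            t * 1#                              ≈⟨ *-identityʳ t ⟩
            t                                   ∎
            where
            t*m11≈ : t * Mat.m11 (Power rot₂ i ◃ u ◃ u) ≈ t * t ^ i + u * u ^ i
            t*m11≈ = ≈-mod-ut+1 (solve 4 (λ t u T U →
              t :* ((T :* u :+ (u :* T :+ u :* U)) :* u :+ T)
              := t :* T :+ u :* U :+ (u :* t :+ 𝟙) :* (u :* U)) refl t u (t ^ i) (u ^ i))

        suffix-m11≉1 : ∀ {x y z i w} → Rotation u u t x y z → NonemptySuffix x y z i w → suc i < m →
                       Mat.m11 (Mn F w) ≉ 1#
        suffix-m11≉1 {i = i} r blocks 1+i<m m11≈1 =
          blocks-m11≉1 r 1+i<m (trans (sym (proj₁ (Mn-repeat₃ r (suc i)))) m11≈1)
        suffix-m11≉1 {x} {y} {z} {i} r blocks+1 1+i<m m11≈1 =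
          blocks+1-m11≉1 r 1+i<m (trans (sym (proj₁ Mn≋)) m11≈1)
          where
          Mn≋ : Mn F (z ∷ repeat₃ x y z i) ≋ Power r i ◃ z
          Mn≋ = ≋-trans (Mn-∷◃ z (repeat₃ x y z i)) (◃-cong z (Mn-repeat₃ r i))
        suffix-m11≉1 {x} {y} {z} {i} r blocks+2 _ m11≈1 =
          blocks+2-m11≉1 r (trans (sym (proj₁ Mn≋)) m11≈1)
          where
          Mn≋ : Mn F (y ∷ z ∷ repeat₃ x y z i) ≋ Power r i ◃ z ◃ y
          Mn≋ = ≋-trans (Mn-∷◃ y (z ∷ repeat₃ x y z i))
                  (◃-cong y (≋-trans (Mn-∷◃ z (repeat₃ x y z i)) (◃-cong z (Mn-repeat₃ r i))))

        rotation-m11≉1 : ∀ {x y z} → Rotation u u t x y z → ∀ pre w → 3 ≤ length pre → 1 ≤ length w →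
                         Pointwise _≈_ (repeat₃ x y z m) (pre ++ w) → Mat.m11 (Mn F w) ≉ 1#
        rotation-m11≉1 {x} {y} {z} r pre w 3≤|pre| 1≤|w| xyzᵐ≈pre++w m11≈1 =
          let i , 1+i<m , suffix = drop-repeat₃-≥3 x y z (length pre) m 3≤|pre| |pre|<3m
          in suffix-m11≉1 r suffix 1+i<m
               (trans (proj₁ (Mn-cong (Pointwise-drop (repeat₃ x y z m) pre w xyzᵐ≈pre++w))) m11≈1)
          where
          |pre|<3m : length pre < m ℕ.* 3
          |pre|<3m = ≡.subst (length pre <_)
            (≡.trans (≡.sym (List.length-++ pre))
              (≡.trans (≡.sym (Pointwise-length xyzᵐ≈pre++w)) (length-repeat₃ x y z m)))
            (ℕ.m<m+n (length pre) 1≤|w|)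

        no-gluing : ∀ {k pre w} → k ≤ m ℕ.* 3 → 3 ≤ length pre → 1 ≤ length w → Mat.m11 (Mn F w) ≈ 1# →
                    ¬ (_≈L_ F (rotate F k (repeat₃ u u t m)) (pre ++ w)
                       ⊎ _≈L_ F (rotate F k (reverse (repeat₃ u u t m))) (pre ++ w))
        no-gluing {k} {pre} {w} k≤3m 3≤|pre| 1≤|w| m11≈1 (inj₁ rotation≈) =
          let _ , _ , _ , r , rotation≡ = rotate-repeat₃ k m {u} {u} {t} k≤3m
          in rotation-m11≉1 r pre w 3≤|pre| 1≤|w|
               (≡.subst (λ xs → _≈L_ F xs (pre ++ w)) rotation≡ rotation≈) m11≈1
        no-gluing {k} {pre} {w} k≤3m 3≤|pre| 1≤|w| m11≈1 (inj₂ reflection≈) =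
          let _ , _ , _ , r , rotation≡ = rotate-repeat₃ k m {t} {u} {u} k≤3m
          in rotation-m11≉1 (Rotation-shift (Rotation-shift r)) pre w 3≤|pre| 1≤|w|
               (≡.subst (λ xs → _≈L_ F xs (pre ++ w))
                 (≡.trans (≡.cong (rotate F k) (reverse-repeat₃ u u t m)) rotation≡) reflection≈) m11≈1

      quiddity : IsQuiddity F (repeat₃ u u t m)
      quiddity = inj₁ (≋-trans (Mn-repeat₃ rot₀ m)
        (^order≈1 t-order , refl ,
         trans (+-cong (*-congˡ (^order≈1 t-order)) (*-congˡ (^order≈1 u-order))) u*1+u*1≈0 ,
         ^order≈1 u-order))

      irreducible : Irreducible F (repeat₃ u u t m)
      irreducible = quiddity , 3≤|uutᵐ| , ¬reducible
        where
        3≤|uutᵐ| : 3 ≤ length (repeat₃ u u t m)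
        3≤|uutᵐ| = ≡.subst (3 ≤_) (≡.sym (length-repeat₃ u u t m))
                     (ℕ.*-monoˡ-≤ 3 (ℕ.n≢0⇒n>0 (order≢0 t-order)))
        ¬reducible : ¬ Reducible F (repeat₃ u u t m)
        ¬reducible (as , bs , bs-quiddity , 3≤|bs| , 3≤|as| , k , k<|uutᵐ| , uutᵐ∼as⊕bs) =
          let pre , w , b , z , as⊕bs≡pre++w , bs≡bwz , 3≤|pre| , 1≤|w| =
                ⊕-decomposition as bs 3≤|as| 3≤|bs|
          in no-gluing {pre = pre} {w} (ℕ.<⇒≤ (≡.subst (k <_) (length-repeat₃ u u t m) k<|uutᵐ|))
               3≤|pre| 1≤|w|
               (inner-m11≈1 b w z (≡.subst (IsQuiddity F) bs≡bwz bs-quiddity))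
               (≡.subst (λ ys → _≈L_ F (rotate F k (repeat₃ u u t m)) ys
                               ⊎ _≈L_ F (rotate F k (reverse (repeat₃ u u t m))) ys) as⊕bs≡pre++w uutᵐ∼as⊕bs)

open import Data.Nat using (_*_; _^_; _∸_)
open RepeatedTriples using (repeat₃; length-repeat₃)

theorem6p14 : ∀ {c ℓ : Level} (n : ℕ) → 2 ≤ n →
    (F : CommutativeRing c ℓ) → IsField F → HasCard F (2 ^ n) →
    2 ^ (n ∸ 1) ≤ totient (2 ^ n ∸ 1) →
    ∃ λ cs → Irreducible F cs × (3 * (2 ^ n ∸ 1) ≤ length cs)
theorem6p14 (suc n) (s≤s _) F isField card 2ⁿ⁻¹≤φ =
  let char2 : Characteristic2 F
      char2 = FiniteField.even-card⇒1+1≈0 F isField card (divides (2 ^ n) (ℕ.*-comm 2 (2 ^ n)))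
      t , t-order , t-nonreciprocal =
        CountingReciprocalSums.non-reciprocal-generator F isField char2 card (ℕ.*-monoʳ-≤ 2 2ⁿ⁻¹≤φ)
      u , tu≈1 = proj₂ isField t (FieldProperties.hasOrder⇒≉0 F isField t-order)
      m : ℕ
      m = 2 ^ suc n ∸ 1
  in repeat₃ u u t m ,
     Characteristic2Quiddities.RepeatedUUT.irreducible F char2 tu≈1 isField t-order t-nonreciprocal ,
     ℕ.≤-reflexive (≡.trans (ℕ.*-comm 3 m) (≡.sym (length-repeat₃ u u t m)))
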